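{- Let $n\ge 2$ and let $\mathtt{ClassCyclo}(n)$ be the set of cyclotomic polynomials $\Phi_m(X)$ ($m\ge1$) of degree $n$ that are of the form $X^n+a_kX^k+\dots+a_1X+a_0$ with $k\le n/2$. Then $\mathtt{ClassCyclo}(n)\neq\emptyset$ if and only if $n=2^i3^j$ with integers $i\ge1$, $j\ge0$.
   Context: $\Phi_m(X)=\prod_{1\le k\le m,\ \gcd(k,m)=1}(X-\zeta^k)$ with $\zeta$ a primitive $m$-th root of unity; it is monic, irreducible over $\mathbb{Z}$, of degree $\varphi(m)$. The paper calls a polynomial a suitable PMNS reduction polynomial if it is irreducible in $\mathbb{Z}[X]$, of the form $X^n+a_kX^k+\dots+a_0$ with $n\ge2$ and $k\le n/2$, and with few and small nonzero coefficients; $\mathtt{ClassCyclo}(n)$ is the class of suitable cyclotomic ones of degree $n$. -}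

module Defs where

open import Data.Nat using (ℕ; zero; suc; _∸_; _<_; _/_)
open import Data.Nat.Divisibility using (_∣?_)
open import Data.Integer using (ℤ; +_; -[1+_]; _+_; _*_; -_)
import Data.Integer as ℤ
open import Data.List using (List; []; _∷_; map; reverse; length; foldr; replicate; _++_; filter; upTo)
open import Data.Product using (_×_)
open import Relation.Binary.PropositionalEquality using (_≡_)

-- Polynomials over ℤ as coefficient lists, lowest degree first:
-- a₀ ∷ a₁ ∷ … ∷ aₙ ∷ []  represents  a₀ + a₁ X + … + aₙ Xⁿ.
Poly : Set
Poly = List ℤ

addP : Poly → Poly → Poly
addP []       q        = q
addP p        []       = p
addP (a ∷ p) (b ∷ q)   = (a + b) ∷ addP p q

negP : Poly → Poly
negP = map (-_)

mulP : Poly → Poly → Poly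
mulP []      q = []
mulP (a ∷ p) q = addP (map (a *_) q) (+ 0 ∷ mulP p q)

stripZeros : List ℤ → List ℤ
stripZeros []            = []
stripZeros (+ zero ∷ xs) = stripZeros xs
stripZeros (x ∷ xs)      = x ∷ xs

normalize : Poly → Poly
normalize p = reverse (stripZeros (reverse p))

-- degree of a (nonzero) polynomial; the zero polynomial gets degree 0
deg : Poly → ℕ
deg p = length (normalize p) ∸ 1

coeff : Poly → ℕ → ℤ
coeff []      j       = + 0
coeff (a ∷ p) zero    = a
coeff (a ∷ p) (suc j) = coeff p j

-- long division by a monic polynomial, on coefficient lists written
-- highest degree first; the first argument is the number of quotient
-- coefficients to produce.
private
  tl : List ℤ → List ℤ
  tl []       = []
  tl (_ ∷ xs) = xs

divRev : ℕ → List ℤ → List ℤ → List ℤ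
divRev zero    R       Q = []
divRev (suc t) []      Q = + 0 ∷ divRev t [] Q
divRev (suc t) (r ∷ R) Q = r ∷ divRev t (tl (addP (r ∷ R) (map (λ c → - (r * c)) Q))) Q

divMonic : Poly → Poly → Poly
divMonic p q =
  let P = stripZeros (reverse p)
      Q = stripZeros (reverse q)
  in normalize (reverse (divRev (suc (length P) ∸ length Q) P Q))

XmMinus1 : ℕ → Poly
XmMinus1 m = addP (replicate m (+ 0) ++ (+ 1 ∷ [])) (-[1+ 0 ] ∷ [])

properDivisors : ℕ → List ℕ
properDivisors m = filter (_∣? m) (upTo m)

-- Cyclotomic polynomials via the standard recursion
--   Φ_m = (X^m - 1) / ∏_{d ∣ m, d < m} Φ_d ,
-- with a fuel argument (fuel ≥ m suffices) to make the recursion structural.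
cycloAux : ℕ → ℕ → Poly
cycloAux zero     m = + 1 ∷ []
cycloAux (suc f)  m =
  divMonic (XmMinus1 m) (foldr mulP (+ 1 ∷ []) (map (cycloAux f) (properDivisors m)))

-- Φ m  is the m-th cyclotomic polynomial Φ_m(X) (meaningful for m ≥ 1)
Φ : ℕ → Poly
Φ m = cycloAux m m

HasClassForm : ℕ → Poly → Set
HasClassForm n p = (deg p ≡ n) × (coeff p n ≡ + 1) ×
                   ((j : ℕ) → n / 2 < j → j < n → coeff p j ≡ + 0)

{-# OPTIONS --safe #-}
-- From the recursion Φ_m = (X^m − 1) / ∏_{d ∣ m, d < m} Φ_d one shows by strong induction that Φ_m is
-- monic and X^m − 1 = ∏_{d ∣ m} Φ_d: the division is exact because distinct Φ_d, Φ_e generate an ideal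
-- containing a nonzero integer (apply the Euler operator X·d/dX to X^d − 1, and use Bézout for X^g − 1).
-- Substituting X^p for a prime p then gives Φ_l(X^p) = Φ_{lp} if p ∣ l and Φ_{lp} Φ_l otherwise, so
-- deg Φ_{lp} is p·deg Φ_l or (p − 1)·deg Φ_l.
-- Suppose Φ_m has degree a and no terms strictly between a/2 and a. If m is squarefree, its X^(a−1)
-- coefficient is minus that of Φ_l (m = l p), hence nonzero, so a ≤ 2; and a prime factor ≥ 5 would
-- force a ≥ 4. Otherwise m = l p with p ∣ l, Φ_m = Φ_l(X^p) and the gap descends to Φ_l. By induction m
-- is 3-smooth and a = 1 or a = 2^i 3^j with i ≥ 1. Conversely, starting from Φ_6 = X² − X + 1, the
-- substitution rule gives Φ_{2^(i+1) 3^(j+1)} = X^(2k) − X^k + 1 with k = 2^i 3^j.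
module Submission where

open import Defs
open import Data.Nat using (ℕ; _≤_; _*_; _^_)
open import Data.Product using (_×_; ∃-syntax)
open import Function.Bundles using (_⇔_)
open import Relation.Binary.PropositionalEquality using (_≡_)

open import Algebra.Bundles using (CommutativeRing)
open import Data.Integer.Base as ℤ using (ℤ; +_; -[1+_])
import Data.Integer.Properties as ℤ
import Data.Integer.Tactic.RingSolver as ℤ
open import Data.List.Base using (List; []; _∷_; _++_; map; foldr; filter; replicate; reverse; length; upTo)
open import Data.List.Properties using (length-reverse; unfold-reverse; reverse-++; reverse-map; length-map; reverse-involutive)
open import Data.List.Membership.Propositional using (_∈_; _∉_)
open import Data.List.Membership.Propositional.Properties
  using (∈-filter⁻; ∈-filter⁺; ∈-upTo⁺; ∈-upTo⁻; ∈-map⁺; ∈-map⁻; ∈-++⁺ˡ; ∈-++⁺ʳ; ∈-++⁻)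
open import Data.List.Membership.Propositional.Properties.WithK using (unique∧set⇒bag)
open import Data.List.Relation.Binary.BagAndSetEquality using (∼bag⇒↭)
open import Data.List.Relation.Binary.Permutation.Propositional as ↭ using (_↭_)
open import Data.List.Relation.Unary.All as All using (All; []; _∷_)
open import Data.List.Relation.Unary.All.Properties using (All¬⇒¬Any)
open import Data.List.Relation.Unary.AllPairs using (_∷_)
open import Data.List.Relation.Unary.Any using (here; there)
open import Data.List.Relation.Unary.Unique.Propositional using (Unique)
import Data.List.Relation.Unary.Unique.Propositional.Properties as Unique
open import Data.Maybe.Base using (Maybe; just; nothing)
open import Data.Nat.Base using (zero; suc; _+_; _∸_; _<_; _/_; _%_; s≤s; z≤n; NonZero; >-nonZero; >-nonZero⁻¹)
open import Data.Nat.Coprimality using (Coprime; coprime-divisor)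
open import Data.Nat.Divisibility
  using (_∣_; _∣?_; divides; ∣⇒≤; ∣-refl; ∣-trans; ∣-antisym; 0∣⇒≡0; n∣m*n; m∣m*n; *-monoˡ-∣; *-cancelʳ-∣)
open import Data.Nat.DivMod using (m≡m%n+[m/n]*n; m%n<n; m*n/n≡m; m<n*o⇒m/o<n)
open import Data.Nat.GCD using (GCD; module GCD; module Bézout)
open import Data.Nat.Induction using (<-rec)
open import Data.Nat.ListAction using (product)
open import Data.Nat.Primality
  using (Prime; prime?; prime[2]; prime⇒irreducible; prime⇒nonZero; euclidsLemma; ¬prime[0]; ¬prime[1]; composite[4]; composite⇒¬prime)
open import Data.Nat.Primality.Factorisation using (factorise)
import Data.Nat.Properties as ℕ
import Data.Nat.Tactic.RingSolver as ℕ
open import Data.List.Membership.DecPropositional ℕ._≟_ using (_∈?_)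
open import Data.Product.Base using (_,_; proj₁; proj₂; ∃₂)
open import Data.Sum.Base using (_⊎_; inj₁; inj₂; [_,_]′)
open import Function.Base using (_∘_; id; flip)
open import Function.Bundles using (mk⇔)
open import Level using (0ℓ)
open import Relation.Binary.Bundles using (Setoid)
open import Relation.Binary.Definitions using (tri<; tri≈; tri>)
open import Relation.Binary.PropositionalEquality as ≡
  using (_≢_; refl; sym; trans; cong; cong₂; subst; module ≡-Reasoning)
import Relation.Binary.Reasoning.Setoid
open import Relation.Binary.Structures using (IsEquivalence)
open import Relation.Nullary.Decidable using (Dec; yes; no; ¬?; _×-dec_; from-yes)
open import Relation.Nullary.Negation using (¬_; contradiction)
open import Relation.Unary using (Decidable)
open import Tactic.RingSolver.Core.AlmostCommutativeRing using (fromCommutativeRing)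

-- Polynomials over ℤ up to equality of coefficients

infix  4 _≈_
infixl 6 _⊕_ _⊝_
infixl 7 _⊗_
infixr 8 _·_

record _≈_ (p q : Poly) : Set where
  constructor mk≈
  field coeff-≡ : ∀ j → coeff p j ≡ coeff q j
open _≈_

≈-refl : ∀ {p} → p ≈ p
≈-refl = mk≈ λ _ → refl

≈-sym : ∀ {p q} → p ≈ q → q ≈ p
≈-sym e = mk≈ λ j → sym (coeff-≡ e j)

≈-trans : ∀ {p q r} → p ≈ q → q ≈ r → p ≈ r
≈-trans e f = mk≈ λ j → trans (coeff-≡ e j) (coeff-≡ f j)

≈-reflexive : ∀ {p q} → p ≡ q → p ≈ q
≈-reflexive refl = ≈-refl

≈-isEquivalence : IsEquivalence _≈_
≈-isEquivalence = record { refl = ≈-refl ; sym = ≈-sym ; trans = ≈-trans }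

≈-setoid : Setoid 0ℓ 0ℓ
≈-setoid = record { isEquivalence = ≈-isEquivalence }

module ≈-Reasoning = Relation.Binary.Reasoning.Setoid ≈-setoid

_⊕_ _⊗_ _⊝_ : Poly → Poly → Poly
_⊕_ = addP
_⊗_ = mulP
p ⊝ q = p ⊕ negP q

_·_ : ℤ → Poly → Poly
a · p = map (a ℤ.*_) p

0P 1P : Poly
0P = []
1P = + 1 ∷ []

const : ℤ → Poly
const c = c ∷ []

coeff-⊕ : ∀ p q j → coeff (p ⊕ q) j ≡ coeff p j ℤ.+ coeff q j
coeff-⊕ []      q       j       = sym (ℤ.+-identityˡ _)
coeff-⊕ (a ∷ p) []      j       = sym (ℤ.+-identityʳ _)
coeff-⊕ (a ∷ p) (b ∷ q) zero    = refl
coeff-⊕ (a ∷ p) (b ∷ q) (suc j) = coeff-⊕ p q j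

coeff-· : ∀ a p j → coeff (a · p) j ≡ a ℤ.* coeff p j
coeff-· a []      j       = sym (ℤ.*-zeroʳ a)
coeff-· a (x ∷ p) zero    = refl
coeff-· a (x ∷ p) (suc j) = coeff-· a p j

coeff-negP : ∀ p j → coeff (negP p) j ≡ ℤ.- coeff p j
coeff-negP []      j       = refl
coeff-negP (x ∷ p) zero    = refl
coeff-negP (x ∷ p) (suc j) = coeff-negP p j

coeff-⊝ : ∀ p q j → coeff (p ⊝ q) j ≡ coeff p j ℤ.- coeff q j
coeff-⊝ p q j = trans (coeff-⊕ p (negP q) j) (cong (ℤ._+_ (coeff p j)) (coeff-negP q j))

∷-cong : ∀ {a b p q} → a ≡ b → p ≈ q → a ∷ p ≈ b ∷ q
∷-cong a≡b p≈q = mk≈ λ { zero → a≡b ; (suc j) → coeff-≡ p≈q j }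

∷-injective : ∀ {a b p q} → a ∷ p ≈ b ∷ q → p ≈ q
∷-injective e = mk≈ λ j → coeff-≡ e (suc j)

∷≈0-head : ∀ {a p} → a ∷ p ≈ 0P → a ≡ + 0
∷≈0-head e = coeff-≡ e zero

∷≈0-tail : ∀ {a p} → a ∷ p ≈ 0P → p ≈ 0P
∷≈0-tail e = mk≈ λ j → coeff-≡ e (suc j)

0∷-≈0 : ∀ {p} → p ≈ 0P → + 0 ∷ p ≈ 0P
0∷-≈0 e = mk≈ λ { zero → refl ; (suc j) → coeff-≡ e j }

⊕-cong : ∀ {p p′ q q′} → p ≈ p′ → q ≈ q′ → p ⊕ q ≈ p′ ⊕ q′
⊕-cong {p} {p′} {q} {q′} e f = mk≈ λ j → begin
  coeff (p ⊕ q) j             ≡⟨ coeff-⊕ p q j ⟩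
  coeff p j ℤ.+ coeff q j     ≡⟨ cong₂ ℤ._+_ (coeff-≡ e j) (coeff-≡ f j) ⟩
  coeff p′ j ℤ.+ coeff q′ j   ≡⟨ coeff-⊕ p′ q′ j ⟨
  coeff (p′ ⊕ q′) j           ∎
  where open ≡-Reasoning

·-congˡ : ∀ a {p q} → p ≈ q → a · p ≈ a · q
·-congˡ a {p} {q} e = mk≈ λ j →
  trans (coeff-· a p j) (trans (cong (a ℤ.*_) (coeff-≡ e j)) (sym (coeff-· a q j)))

negP-cong : ∀ {p q} → p ≈ q → negP p ≈ negP q
negP-cong {p} {q} e = mk≈ λ j →
  trans (coeff-negP p j) (trans (cong ℤ.-_ (coeff-≡ e j)) (sym (coeff-negP q j)))

⊕-comm : ∀ p q → p ⊕ q ≈ q ⊕ p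
⊕-comm p q = mk≈ λ j →
  trans (coeff-⊕ p q j) (trans (ℤ.+-comm (coeff p j) (coeff q j)) (sym (coeff-⊕ q p j)))

⊕-assoc : ∀ p q r → (p ⊕ q) ⊕ r ≈ p ⊕ (q ⊕ r)
⊕-assoc p q r = mk≈ λ j → begin
  coeff ((p ⊕ q) ⊕ r) j                         ≡⟨ coeff-⊕ (p ⊕ q) r j ⟩
  coeff (p ⊕ q) j ℤ.+ coeff r j                 ≡⟨ cong (ℤ._+ coeff r j) (coeff-⊕ p q j) ⟩
  (coeff p j ℤ.+ coeff q j) ℤ.+ coeff r j       ≡⟨ ℤ.+-assoc (coeff p j) (coeff q j) (coeff r j) ⟩
  coeff p j ℤ.+ (coeff q j ℤ.+ coeff r j)       ≡⟨ cong (ℤ._+_ (coeff p j)) (coeff-⊕ q r j) ⟨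
  coeff p j ℤ.+ coeff (q ⊕ r) j                 ≡⟨ coeff-⊕ p (q ⊕ r) j ⟨
  coeff (p ⊕ (q ⊕ r)) j                         ∎
  where open ≡-Reasoning

⊕-identityˡ : ∀ p → 0P ⊕ p ≈ p
⊕-identityˡ p = ≈-refl

⊕-identityʳ : ∀ p → p ⊕ 0P ≈ p
⊕-identityʳ []      = ≈-refl
⊕-identityʳ (x ∷ p) = ≈-refl

⊕-inverseʳ : ∀ p → p ⊕ negP p ≈ 0P
⊕-inverseʳ p = mk≈ λ j → trans (coeff-⊝ p p j) (ℤ.+-inverseʳ (coeff p j))

⊕-inverseˡ : ∀ p → negP p ⊕ p ≈ 0P
⊕-inverseˡ p = ≈-trans (⊕-comm (negP p) p) (⊕-inverseʳ p)

⊕-interchange : ∀ p q r s → (p ⊕ q) ⊕ (r ⊕ s) ≈ (p ⊕ r) ⊕ (q ⊕ s)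
⊕-interchange p q r s = mk≈ λ j → begin
  coeff ((p ⊕ q) ⊕ (r ⊕ s)) j
    ≡⟨ trans (coeff-⊕ (p ⊕ q) (r ⊕ s) j) (cong₂ ℤ._+_ (coeff-⊕ p q j) (coeff-⊕ r s j)) ⟩
  (coeff p j ℤ.+ coeff q j) ℤ.+ (coeff r j ℤ.+ coeff s j)
    ≡⟨ interchange (coeff p j) (coeff q j) (coeff r j) (coeff s j) ⟩
  (coeff p j ℤ.+ coeff r j) ℤ.+ (coeff q j ℤ.+ coeff s j)
    ≡⟨ trans (coeff-⊕ (p ⊕ r) (q ⊕ s) j) (cong₂ ℤ._+_ (coeff-⊕ p r j) (coeff-⊕ q s j)) ⟨
  coeff ((p ⊕ r) ⊕ (q ⊕ s)) j ∎
  where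
  open ≡-Reasoning
  interchange : ∀ (a b c d : ℤ) → (a ℤ.+ b) ℤ.+ (c ℤ.+ d) ≡ (a ℤ.+ c) ℤ.+ (b ℤ.+ d)
  interchange = ℤ.solve-∀

·-zero : ∀ p → (+ 0) · p ≈ 0P
·-zero p = mk≈ (coeff-· (+ 0) p)

·-distribˡ-⊕ : ∀ a p q → a · (p ⊕ q) ≈ a · p ⊕ a · q
·-distribˡ-⊕ a p q = mk≈ λ j → begin
  coeff (a · (p ⊕ q)) j                      ≡⟨ coeff-· a (p ⊕ q) j ⟩
  a ℤ.* coeff (p ⊕ q) j                      ≡⟨ cong (a ℤ.*_) (coeff-⊕ p q j) ⟩
  a ℤ.* (coeff p j ℤ.+ coeff q j)            ≡⟨ ℤ.*-distribˡ-+ a (coeff p j) (coeff q j) ⟩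
  a ℤ.* coeff p j ℤ.+ a ℤ.* coeff q j        ≡⟨ cong₂ ℤ._+_ (coeff-· a p j) (coeff-· a q j) ⟨
  coeff (a · p) j ℤ.+ coeff (a · q) j        ≡⟨ coeff-⊕ (a · p) (a · q) j ⟨
  coeff (a · p ⊕ a · q) j                    ∎
  where open ≡-Reasoning

·-distribʳ-+ : ∀ a b p → (a ℤ.+ b) · p ≈ a · p ⊕ b · p
·-distribʳ-+ a b p = mk≈ λ j → begin
  coeff ((a ℤ.+ b) · p) j                    ≡⟨ coeff-· (a ℤ.+ b) p j ⟩
  (a ℤ.+ b) ℤ.* coeff p j                    ≡⟨ ℤ.*-distribʳ-+ (coeff p j) a b ⟩
  a ℤ.* coeff p j ℤ.+ b ℤ.* coeff p j        ≡⟨ cong₂ ℤ._+_ (coeff-· a p j) (coeff-· b p j) ⟨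
  coeff (a · p) j ℤ.+ coeff (b · p) j        ≡⟨ coeff-⊕ (a · p) (b · p) j ⟨
  coeff (a · p ⊕ b · p) j                    ∎
  where open ≡-Reasoning

·-assoc : ∀ a b p → a · b · p ≈ (a ℤ.* b) · p
·-assoc a b p = mk≈ λ j → begin
  coeff (a · b · p) j             ≡⟨ coeff-· a (b · p) j ⟩
  a ℤ.* coeff (b · p) j           ≡⟨ cong (a ℤ.*_) (coeff-· b p j) ⟩
  a ℤ.* (b ℤ.* coeff p j)         ≡⟨ ℤ.*-assoc a b (coeff p j) ⟨
  a ℤ.* b ℤ.* coeff p j           ≡⟨ coeff-· (a ℤ.* b) p j ⟨
  coeff ((a ℤ.* b) · p) j         ∎
  where open ≡-Reasoning

≈0-⊗ : ∀ {p} q → p ≈ 0P → p ⊗ q ≈ 0P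
≈0-⊗ {[]}    q e = ≈-refl
≈0-⊗ {a ∷ p} q e rewrite ∷≈0-head e =
  ⊕-cong (·-zero q) (0∷-≈0 (≈0-⊗ {p} q (∷≈0-tail e)))

⊗-zeroʳ : ∀ p → p ⊗ 0P ≈ 0P
⊗-zeroʳ []      = ≈-refl
⊗-zeroʳ (a ∷ p) = 0∷-≈0 (⊗-zeroʳ p)

⊗-congʳ : ∀ {p p′} q → p ≈ p′ → p ⊗ q ≈ p′ ⊗ q
⊗-congʳ {[]}    {p′}     q e = ≈-sym (≈0-⊗ q (≈-sym e))
⊗-congʳ {a ∷ p} {[]}     q e = ≈0-⊗ q e
⊗-congʳ {a ∷ p} {b ∷ p′} q e rewrite coeff-≡ e zero =
  ⊕-cong (≈-refl {b · q}) (∷-cong refl (⊗-congʳ q (∷-injective e)))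

⊗-congˡ : ∀ p {q q′} → q ≈ q′ → p ⊗ q ≈ p ⊗ q′
⊗-congˡ []      e = ≈-refl
⊗-congˡ (a ∷ p) e = ⊕-cong (·-congˡ a e) (∷-cong refl (⊗-congˡ p e))

⊗-cong : ∀ {p p′ q q′} → p ≈ p′ → q ≈ q′ → p ⊗ q ≈ p′ ⊗ q′
⊗-cong {p} {p′} {q} e f = ≈-trans (⊗-congʳ q e) (⊗-congˡ p′ f)

0∷-⊗ : ∀ p q → (+ 0 ∷ p) ⊗ q ≈ + 0 ∷ p ⊗ q
0∷-⊗ p q = ⊕-cong (·-zero q) ≈-refl

⊗-distribʳ-⊕ : ∀ p p′ q → (p ⊕ p′) ⊗ q ≈ p ⊗ q ⊕ p′ ⊗ q
⊗-distribʳ-⊕ []      p′       q = ≈-refl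
⊗-distribʳ-⊕ (a ∷ p) []       q = ≈-sym (⊕-identityʳ _)
⊗-distribʳ-⊕ (a ∷ p) (b ∷ p′) q =
  ≈-trans (⊕-cong (·-distribʳ-+ a b q) (∷-cong refl (⊗-distribʳ-⊕ p p′ q)))
          (⊕-interchange (a · q) (b · q) (+ 0 ∷ p ⊗ q) (+ 0 ∷ p′ ⊗ q))

⊗-distribˡ-⊕ : ∀ p q q′ → p ⊗ (q ⊕ q′) ≈ p ⊗ q ⊕ p ⊗ q′
⊗-distribˡ-⊕ []      q q′ = ≈-refl
⊗-distribˡ-⊕ (a ∷ p) q q′ =
  ≈-trans (⊕-cong (·-distribˡ-⊕ a q q′) (∷-cong refl (⊗-distribˡ-⊕ p q q′)))
          (⊕-interchange (a · q) (a · q′) (+ 0 ∷ p ⊗ q) (+ 0 ∷ p ⊗ q′))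

·-⊗ : ∀ a p q → a · p ⊗ q ≈ a · (p ⊗ q)
·-⊗ a []      q = ≈-refl
·-⊗ a (b ∷ p) q =
  ≈-trans (⊕-cong (≈-sym (·-assoc a b q)) (∷-cong (sym (ℤ.*-zeroʳ a)) (·-⊗ a p q)))
          (≈-sym (·-distribˡ-⊕ a (b · q) (+ 0 ∷ p ⊗ q)))

⊗-assoc : ∀ p q r → (p ⊗ q) ⊗ r ≈ p ⊗ (q ⊗ r)
⊗-assoc []      q r = ≈-refl
⊗-assoc (a ∷ p) q r =
  ≈-trans (⊗-distribʳ-⊕ (a · q) (+ 0 ∷ p ⊗ q) r)
          (⊕-cong (·-⊗ a q r) (≈-trans (0∷-⊗ (p ⊗ q) r) (∷-cong refl (⊗-assoc p q r))))

⊗-∷ : ∀ p b q → p ⊗ (b ∷ q) ≈ b · p ⊕ (+ 0 ∷ p ⊗ q)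
⊗-∷ []      b q = ≈-sym (0∷-≈0 ≈-refl)
⊗-∷ (a ∷ p) b q = mk≈ λ
  { zero    → trans (ℤ.+-identityʳ _) (trans (ℤ.*-comm a b) (sym (ℤ.+-identityʳ _)))
  ; (suc j) → begin
      coeff (a · q ⊕ p ⊗ (b ∷ q)) j
        ≡⟨ coeff-⊕ (a · q) (p ⊗ (b ∷ q)) j ⟩
      coeff (a · q) j ℤ.+ coeff (p ⊗ (b ∷ q)) j
        ≡⟨ cong (ℤ._+_ (coeff (a · q) j)) (trans (coeff-≡ (⊗-∷ p b q) j) (coeff-⊕ (b · p) _ j)) ⟩
      coeff (a · q) j ℤ.+ (coeff (b · p) j ℤ.+ coeff (+ 0 ∷ p ⊗ q) j)
        ≡⟨ swap (coeff (a · q) j) (coeff (b · p) j) _ ⟩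
      coeff (b · p) j ℤ.+ (coeff (a · q) j ℤ.+ coeff (+ 0 ∷ p ⊗ q) j)
        ≡⟨ cong (ℤ._+_ (coeff (b · p) j)) (coeff-⊕ (a · q) (+ 0 ∷ p ⊗ q) j) ⟨
      coeff (b · p) j ℤ.+ coeff (a · q ⊕ (+ 0 ∷ p ⊗ q)) j
        ≡⟨ coeff-⊕ (b · p) (a · q ⊕ (+ 0 ∷ p ⊗ q)) j ⟨
      coeff (b · p ⊕ (a · q ⊕ (+ 0 ∷ p ⊗ q))) j ∎ }
  where
  open ≡-Reasoning
  swap : ∀ (x y z : ℤ) → x ℤ.+ (y ℤ.+ z) ≡ y ℤ.+ (x ℤ.+ z)
  swap = ℤ.solve-∀

⊗-comm : ∀ p q → p ⊗ q ≈ q ⊗ p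
⊗-comm []      q = ≈-sym (⊗-zeroʳ q)
⊗-comm (a ∷ p) q = ≈-trans (⊕-cong (≈-refl {a · q}) (∷-cong refl (⊗-comm p q))) (≈-sym (⊗-∷ q a p))

⊗-· : ∀ a p q → p ⊗ a · q ≈ a · (p ⊗ q)
⊗-· a p q = ≈-trans (⊗-comm p (a · q)) (≈-trans (·-⊗ a q p) (·-congˡ a (⊗-comm q p)))

1·-identity : ∀ p → (+ 1) · p ≈ p
1·-identity p = mk≈ λ j → trans (coeff-· (+ 1) p j) (ℤ.*-identityˡ _)

⊗-identityˡ : ∀ p → 1P ⊗ p ≈ p
⊗-identityˡ p = ≈-trans (⊕-identityʳ′ ((+ 1) · p)) (1·-identity p)
  where
  ⊕-identityʳ′ : ∀ q → q ⊕ (+ 0 ∷ []) ≈ q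
  ⊕-identityʳ′ q = ≈-trans (⊕-cong (≈-refl {q}) (0∷-≈0 ≈-refl)) (⊕-identityʳ q)

⊗-identityʳ : ∀ p → p ⊗ 1P ≈ p
⊗-identityʳ p = ≈-trans (⊗-comm p 1P) (⊗-identityˡ p)

commutativeRing : CommutativeRing 0ℓ 0ℓ
commutativeRing = record
  { Carrier = Poly ; _≈_ = _≈_ ; _+_ = _⊕_ ; _*_ = _⊗_ ; -_ = negP ; 0# = 0P ; 1# = 1P
  ; isCommutativeRing = record
    { isRing = record
      { +-isAbelianGroup = record
        { isGroup = record
          { isMonoid = record
            { isSemigroup = record
              { isMagma = record { isEquivalence = ≈-isEquivalence ; ∙-cong = ⊕-cong }
              ; assoc = ⊕-assoc }
            ; identity = ⊕-identityˡ , ⊕-identityʳ }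
          ; inverse = ⊕-inverseˡ , ⊕-inverseʳ
          ; ⁻¹-cong = negP-cong }
        ; comm = ⊕-comm }
      ; *-cong = ⊗-cong
      ; *-assoc = ⊗-assoc
      ; *-identity = ⊗-identityˡ , ⊗-identityʳ
      ; distrib = ⊗-distribˡ-⊕ , λ p q r → ⊗-distribʳ-⊕ q r p }
    ; *-comm = ⊗-comm } }

-- Only literal zero lists are recognised, which is all the ring solver needs.
≟0P : ∀ p → Maybe (0P ≈ p)
≟0P []          = just ≈-refl
≟0P (+ 0 ∷ p)   with ≟0P p
... | just e    = just (≈-sym (0∷-≈0 (≈-sym e)))
... | nothing   = nothing
≟0P (_ ∷ p)     = nothing

open import Tactic.RingSolver.NonReflective (fromCommutativeRing commutativeRing ≟0P)
  using (solve; Κ)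
  renaming (_⊜_ to infix 4 _:=_; _⊕_ to infixl 6 _:+_; _⊗_ to infixl 7 _:*_; ⊝_ to infix 8 :-_)

-- Monomials, degree bounds and normal forms

1≢0 : + 1 ≢ + 0
1≢0 ()

shift : ℕ → Poly → Poly
shift k p = replicate k (+ 0) ++ p

X^_ : ℕ → Poly
X^ n = shift n 1P

coeff-shift : ∀ k p j → coeff (shift k p) (k + j) ≡ coeff p j
coeff-shift zero    p j = refl
coeff-shift (suc k) p j = coeff-shift k p j

coeff-shift-< : ∀ k p {j} → j < k → coeff (shift k p) j ≡ + 0
coeff-shift-< (suc k) p {zero}  _         = refl
coeff-shift-< (suc k) p {suc j} (s≤s j<k) = coeff-shift-< k p j<k

coeff-X^-≡ : ∀ n → coeff (X^ n) n ≡ + 1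
coeff-X^-≡ zero    = refl
coeff-X^-≡ (suc n) = coeff-X^-≡ n

coeff-X^-≢ : ∀ n {j} → j ≢ n → coeff (X^ n) j ≡ + 0
coeff-X^-≢ zero    {zero}  j≢n = contradiction refl j≢n
coeff-X^-≢ zero    {suc j} j≢n = refl
coeff-X^-≢ (suc n) {zero}  j≢n = refl
coeff-X^-≢ (suc n) {suc j} j≢n = coeff-X^-≢ n (λ j≡n → j≢n (cong suc j≡n))

coeff-beyond-length : ∀ p {j} → length p ≤ j → coeff p j ≡ + 0
coeff-beyond-length []      _         = refl
coeff-beyond-length (x ∷ p) (s≤s le) = coeff-beyond-length p le

shift-cong : ∀ k {p q} → p ≈ q → shift k p ≈ shift k q
shift-cong zero    e = e
shift-cong (suc k) e = ∷-cong refl (shift-cong k e)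

shift-⊗ : ∀ k p q → shift k p ⊗ q ≈ shift k (p ⊗ q)
shift-⊗ zero    p q = ≈-refl
shift-⊗ (suc k) p q = ≈-trans (0∷-⊗ (shift k p) q) (∷-cong refl (shift-⊗ k p q))

shift-⊕ : ∀ k p q → shift k (p ⊕ q) ≈ shift k p ⊕ shift k q
shift-⊕ zero    p q = ≈-refl
shift-⊕ (suc k) p q = ∷-cong refl (shift-⊕ k p q)

shift-· : ∀ k a p → shift k (a · p) ≈ a · shift k p
shift-· zero    a p = ≈-refl
shift-· (suc k) a p = ∷-cong (sym (ℤ.*-zeroʳ a)) (shift-· k a p)

shift-0P : ∀ k → shift k 0P ≈ 0P
shift-0P zero    = ≈-refl
shift-0P (suc k) = 0∷-≈0 (shift-0P k)

shift≈X^⊗ : ∀ k p → shift k p ≈ X^ k ⊗ p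
shift≈X^⊗ k p = ≈-sym (≈-trans (shift-⊗ k 1P p) (shift-cong k (⊗-identityˡ p)))

X^-+ : ∀ a b → X^ a ⊗ X^ b ≈ X^ (a + b)
X^-+ zero    b = ⊗-identityˡ (X^ b)
X^-+ (suc a) b = ≈-trans (0∷-⊗ (X^ a) (X^ b)) (∷-cong refl (X^-+ a b))

X^-cong : ∀ {a b} → a ≡ b → X^ a ≈ X^ b
X^-cong refl = ≈-refl

∷≈const⊕X⊗ : ∀ a p → a ∷ p ≈ const a ⊕ X^ 1 ⊗ p
∷≈const⊕X⊗ a p = ≈-sym (≈-trans (⊕-cong (≈-refl {const a}) (≈-sym (shift≈X^⊗ 1 p)))
                                 (∷-cong (ℤ.+-identityʳ a) (⊕-identityˡ p)))

const-⊗ : ∀ c p → const c ⊗ p ≈ c · p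
const-⊗ c p = ≈-trans (⊕-cong (≈-refl {c · p}) (0∷-≈0 ≈-refl)) (⊕-identityʳ (c · p))

const-0 : const (+ 0) ≈ 0P
const-0 = 0∷-≈0 ≈-refl

infix 4 _deg<_ _deg≤_
_deg<_ _deg≤_ : Poly → ℕ → Set
p deg< n = ∀ j → n ≤ j → coeff p j ≡ + 0
p deg≤ n = p deg< suc n

deg<-cong : ∀ {p q n} → p ≈ q → p deg< n → q deg< n
deg<-cong e d j n≤j = trans (sym (coeff-≡ e j)) (d j n≤j)

deg<-mono : ∀ {p a b} → a ≤ b → p deg< a → p deg< b
deg<-mono a≤b d j b≤j = d j (ℕ.≤-trans a≤b b≤j)

deg<-length : ∀ p → p deg< length p
deg<-length p j le = coeff-beyond-length p le

leading-unique : ∀ {p a b} → p deg≤ a → coeff p a ≢ + 0 → p deg≤ b → coeff p b ≢ + 0 → a ≡ b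
leading-unique {a = a} {b} da na db nb with ℕ.<-cmp a b
... | tri< a<b _ _ = contradiction (da b a<b) nb
... | tri≈ _ a≡b _ = a≡b
... | tri> _ _ b<a = contradiction (db a b<a) na

⊗-leading : ∀ f n g m → f deg≤ n → g deg≤ m →
            (f ⊗ g) deg≤ (n + m) × coeff (f ⊗ g) (n + m) ≡ coeff f n ℤ.* coeff g m
⊗-leading []      n       g m df dg = (λ _ _ → refl) , refl
⊗-leading (a ∷ f) zero    g m df dg = bounded , lead
  where
  f≈0 : f ≈ 0P
  f≈0 = mk≈ λ j → df (suc j) (s≤s z≤n)
  a∷f⊗g : (a ∷ f) ⊗ g ≈ a · g
  a∷f⊗g = ≈-trans (⊕-cong (≈-refl {a · g}) (0∷-≈0 (≈0-⊗ g f≈0))) (⊕-identityʳ (a · g))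
  bounded : ((a ∷ f) ⊗ g) deg≤ m
  bounded j m<j = trans (coeff-≡ a∷f⊗g j)
                (trans (coeff-· a g j) (trans (cong (a ℤ.*_) (dg j m<j)) (ℤ.*-zeroʳ a)))
  lead : coeff ((a ∷ f) ⊗ g) m ≡ a ℤ.* coeff g m
  lead = trans (coeff-≡ a∷f⊗g m) (coeff-· a g m)
⊗-leading (a ∷ f) (suc n) g m df dg = bounded , lead
  where
  ih : (f ⊗ g) deg≤ (n + m) × coeff (f ⊗ g) (n + m) ≡ coeff f n ℤ.* coeff g m
  ih = ⊗-leading f n g m (λ j n<j → df (suc j) (s≤s n<j)) dg
  a·g-vanishes : ∀ j → n + m ≤ j → coeff (a · g) (suc j) ≡ + 0
  a·g-vanishes j le = trans (coeff-· a g (suc j))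
    (trans (cong (a ℤ.*_) (dg (suc j) (s≤s (ℕ.≤-trans (ℕ.m≤n+m m n) le)))) (ℤ.*-zeroʳ a))
  bounded : ((a ∷ f) ⊗ g) deg≤ (suc n + m)
  bounded (suc j) (s≤s lt) = trans (coeff-⊕ (a · g) (+ 0 ∷ f ⊗ g) (suc j))
    (cong₂ ℤ._+_ (a·g-vanishes j (ℕ.<⇒≤ lt)) (proj₁ ih j lt))
  lead : coeff ((a ∷ f) ⊗ g) (suc n + m) ≡ coeff f n ℤ.* coeff g m
  lead = trans (coeff-⊕ (a · g) (+ 0 ∷ f ⊗ g) (suc (n + m)))
    (trans (cong₂ ℤ._+_ (a·g-vanishes (n + m) ℕ.≤-refl) (proj₂ ih)) (ℤ.+-identityˡ _))
  
record Monic (f : Poly) (n : ℕ) : Set where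
  constructor _,_
  field
    bound   : f deg≤ n
    leading : coeff f n ≡ + 1

Monic-leading≢0 : ∀ {f n} → Monic f n → coeff f n ≢ + 0
Monic-leading≢0 (_ , c) c≡0 = 1≢0 (trans (sym c) c≡0)

Monic-⊗ : ∀ {f g n m} → Monic f n → Monic g m → Monic (f ⊗ g) (n + m)
Monic-⊗ {f} {g} {n} {m} (df , cf) (dg , cg) with ⊗-leading f n g m df dg
... | d , c = d , trans c (cong₂ ℤ._*_ cf cg)

Monic-1P : Monic 1P 0
Monic-1P = (λ { (suc j) _ → refl }) , refl

private
  stripZeros-++ : List ℤ → List ℤ → List ℤ
  stripZeros-++ []       ys = stripZeros ys
  stripZeros-++ (s ∷ ss) ys = s ∷ ss ++ ys

  stripZeros-++-≡ : ∀ xs ys → stripZeros (xs ++ ys) ≡ stripZeros-++ (stripZeros xs) ys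
  stripZeros-++-≡ []              ys = refl
  stripZeros-++-≡ (+ zero ∷ xs)   ys = stripZeros-++-≡ xs ys
  stripZeros-++-≡ (+ suc n ∷ xs)  ys = refl
  stripZeros-++-≡ (-[1+ n ] ∷ xs) ys = refl

  cons-normal : ℤ → List ℤ → List ℤ
  cons-normal a []       = normalize (a ∷ [])
  cons-normal a (x ∷ xs) = a ∷ x ∷ xs

  cons-normal-≈ : ∀ a L → cons-normal a L ≈ a ∷ L
  cons-normal-≈ (+ zero)   []      = ≈-sym (0∷-≈0 ≈-refl)
  cons-normal-≈ (+ suc n)  []      = ≈-refl
  cons-normal-≈ -[1+ n ]   []      = ≈-refl
  cons-normal-≈ a          (x ∷ L) = ≈-refl

normalize-∷ : ∀ a p → normalize (a ∷ p) ≡ cons-normal a (normalize p)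
normalize-∷ a p with stripZeros (reverse p) in eq
... | [] = begin
  reverse (stripZeros (reverse (a ∷ p)))             ≡⟨ cong (reverse ∘ stripZeros) (unfold-reverse a p) ⟩
  reverse (stripZeros (reverse p ++ a ∷ []))         ≡⟨ cong reverse (stripZeros-++-≡ (reverse p) (a ∷ [])) ⟩
  reverse (stripZeros-++ (stripZeros (reverse p)) (a ∷ [])) ≡⟨ cong (λ z → reverse (stripZeros-++ z (a ∷ []))) eq ⟩
  reverse (stripZeros (a ∷ []))                      ∎
  where open ≡-Reasoning
... | s ∷ ss = begin
  reverse (stripZeros (reverse (a ∷ p)))             ≡⟨ cong (reverse ∘ stripZeros) (unfold-reverse a p) ⟩
  reverse (stripZeros (reverse p ++ a ∷ []))         ≡⟨ cong reverse (stripZeros-++-≡ (reverse p) (a ∷ [])) ⟩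
  reverse (stripZeros-++ (stripZeros (reverse p)) (a ∷ [])) ≡⟨ cong (λ z → reverse (stripZeros-++ z (a ∷ []))) eq ⟩
  reverse (s ∷ ss ++ a ∷ [])                         ≡⟨ reverse-++ (s ∷ ss) (a ∷ []) ⟩
  a ∷ reverse (s ∷ ss)                               ≡⟨ cons-normal-nonempty (reverse (s ∷ ss)) (length-reverse (s ∷ ss)) ⟩
  cons-normal a (reverse (s ∷ ss))                   ∎
  where
  open ≡-Reasoning
  cons-normal-nonempty : ∀ L → length L ≡ suc (length ss) → a ∷ L ≡ cons-normal a L
  cons-normal-nonempty (x ∷ L) _ = refl

normalize-≈ : ∀ p → normalize p ≈ p
normalize-≈ []      = ≈-refl
normalize-≈ (a ∷ p) = ≈-trans (≈-reflexive (normalize-∷ a p))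
                              (≈-trans (cons-normal-≈ a (normalize p)) (∷-cong refl (normalize-≈ p)))

normalize-cong : ∀ {p q} → p ≈ q → normalize p ≡ normalize q
normalize-cong {[]}    {[]}    e = refl
normalize-cong {[]}    {b ∷ q} e = begin
  cons-normal (+ 0) (normalize [])  ≡⟨ cong (cons-normal (+ 0)) (normalize-cong {[]} {q} (mk≈ λ j → coeff-≡ e (suc j))) ⟩
  cons-normal (+ 0) (normalize q) ≡⟨ cong (λ z → cons-normal z (normalize q)) (coeff-≡ e zero) ⟩
  cons-normal b (normalize q)    ≡⟨ normalize-∷ b q ⟨
  normalize (b ∷ q)              ∎
  where open ≡-Reasoning
normalize-cong {a ∷ p} {[]}    e = begin
  normalize (a ∷ p)                ≡⟨ normalize-∷ a p ⟩
  cons-normal a (normalize p)      ≡⟨ cong₂ cons-normal (∷≈0-head e) (normalize-cong {p} {[]} (∷≈0-tail e)) ⟩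
  cons-normal (+ 0) (normalize []) ∎
  where open ≡-Reasoning
normalize-cong {a ∷ p} {b ∷ q} e = begin
  normalize (a ∷ p)               ≡⟨ normalize-∷ a p ⟩
  cons-normal a (normalize p)     ≡⟨ cong₂ cons-normal (coeff-≡ e zero) (normalize-cong (∷-injective e)) ⟩
  cons-normal b (normalize q)     ≡⟨ normalize-∷ b q ⟨
  normalize (b ∷ q)               ∎
  where open ≡-Reasoning

deg-cong : ∀ {p q} → p ≈ q → deg p ≡ deg q
deg-cong e = cong (λ z → length z ∸ 1) (normalize-cong e)

stripZeros-head≢0 : ∀ xs {s ss} → stripZeros xs ≡ s ∷ ss → s ≢ + 0
stripZeros-head≢0 (+ zero ∷ xs)   eq   = stripZeros-head≢0 xs eq
stripZeros-head≢0 (+ suc n ∷ xs)  refl ()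
stripZeros-head≢0 (-[1+ n ] ∷ xs) refl ()

stripZeros-reverse-≈ : ∀ p {L} → stripZeros (reverse p) ≡ L → reverse L ≈ p
stripZeros-reverse-≈ p eq = ≈-trans (≈-reflexive (cong reverse (sym eq))) (normalize-≈ p)

stripZeros-reverse-[] : ∀ p → stripZeros (reverse p) ≡ [] → p ≈ 0P
stripZeros-reverse-[] p eq = ≈-sym (stripZeros-reverse-≈ p eq)

stripZeros-reverse-∷ : ∀ p {s ss} → stripZeros (reverse p) ≡ s ∷ ss →
                       p deg≤ length ss × coeff p (length ss) ≡ s × s ≢ + 0
stripZeros-reverse-∷ p {s} {ss} eq = bounded , top , stripZeros-head≢0 (reverse p) eq
  where
  L : Poly
  L = reverse (s ∷ ss)
  L≈p : L ≈ p
  L≈p = stripZeros-reverse-≈ p eq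
  bounded : p deg≤ length ss
  bounded j lt = trans (sym (coeff-≡ L≈p j))
    (coeff-beyond-length L (ℕ.≤-trans (ℕ.≤-reflexive (length-reverse (s ∷ ss))) lt))
  coeff-snoc : ∀ xs → coeff (xs ++ s ∷ []) (length xs) ≡ s
  coeff-snoc []       = refl
  coeff-snoc (x ∷ xs) = coeff-snoc xs
  top : coeff p (length ss) ≡ s
  top = begin
    coeff p (length ss)                          ≡⟨ coeff-≡ L≈p (length ss) ⟨
    coeff L (length ss)                          ≡⟨ cong (λ z → coeff z (length ss)) (unfold-reverse s ss) ⟩
    coeff (reverse ss ++ s ∷ []) (length ss)     ≡⟨ cong (coeff (reverse ss ++ s ∷ [])) (length-reverse ss) ⟨
    coeff (reverse ss ++ s ∷ []) (length (reverse ss)) ≡⟨ coeff-snoc (reverse ss) ⟩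
    s                                            ∎
    where open ≡-Reasoning

data Leading (p : Poly) : Set where
  zeroP   : p ≈ 0P → Leading p
  leading : ∀ t → p deg≤ t → coeff p t ≢ + 0 → Leading p

leading? : ∀ p → Leading p
leading? p with stripZeros (reverse p) in eq
... | []     = zeroP (stripZeros-reverse-[] p eq)
... | s ∷ ss with stripZeros-reverse-∷ p eq
...   | bounded , top , s≢0 = leading (length ss) bounded (s≢0 ∘ trans (sym top))

Monic-stripZeros : ∀ {q k} → Monic q k →
                   ∃[ Q ] stripZeros (reverse q) ≡ + 1 ∷ Q × length Q ≡ k
Monic-stripZeros {q} {k} mq with stripZeros (reverse q) in eq
... | []     = contradiction (coeff-≡ (stripZeros-reverse-[] q eq) k) (Monic-leading≢0 mq)
... | s ∷ ss with stripZeros-reverse-∷ q eq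
...   | bounded , top , s≢0 = ss , cong (_∷ ss) s≡1 , length≡k
  where
  length≡k : length ss ≡ k
  length≡k = leading-unique {q} bounded (s≢0 ∘ trans (sym top)) (Monic.bound mq) (Monic-leading≢0 mq)
  s≡1 : s ≡ + 1
  s≡1 = trans (sym top) (trans (cong (coeff q) length≡k) (Monic.leading mq))

Monic⇒deg≡ : ∀ {f n} → Monic f n → deg f ≡ n
Monic⇒deg≡ {f} {n} mf with Monic-stripZeros mf
... | Q , eq , length≡n = begin
  length (reverse (stripZeros (reverse f))) ∸ 1 ≡⟨ cong (λ z → length (reverse z) ∸ 1) eq ⟩
  length (reverse (+ 1 ∷ Q)) ∸ 1                ≡⟨ cong (_∸ 1) (length-reverse (+ 1 ∷ Q)) ⟩
  length Q                                      ≡⟨ length≡n ⟩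
  n                                             ∎
  where open ≡-Reasoning

-- Division by monic polynomials

Monic-⊗-leading : ∀ {f n b t} → Monic f n → b deg≤ t → coeff (f ⊗ b) (n + t) ≡ coeff b t
Monic-⊗-leading {f} {n} {b} {t} (df , cf) db =
  trans (proj₂ (⊗-leading f n b t df db)) (trans (cong (ℤ._* coeff b t) cf) (ℤ.*-identityˡ _))

Monic-⊗-deg< : ∀ {f n} b → Monic f n → (f ⊗ b) deg< n → b ≈ 0P
Monic-⊗-deg< {f} {n} b mf small with leading? b
... | zeroP b≈0          = b≈0
... | leading t db bt≢0 =
  contradiction (trans (sym (Monic-⊗-leading mf db)) (small (n + t) (ℕ.m≤m+n n t))) bt≢0

⊝≈0⇒≈ : ∀ {a b} → a ⊝ b ≈ 0P → a ≈ b
⊝≈0⇒≈ {a} {b} e = mk≈ λ j → ℤ.i-j≡0⇒i≡j _ _ (trans (sym (coeff-⊝ a b j)) (coeff-≡ e j))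

Monic-division-unique : ∀ {f n s s′ r r′} → Monic f n → r deg< n → r′ deg< n →
                        f ⊗ s ⊕ r ≈ f ⊗ s′ ⊕ r′ → s ≈ s′
Monic-division-unique {f} {n} {s} {s′} {r} {r′} mf dr dr′ e =
  ⊝≈0⇒≈ (Monic-⊗-deg< (s ⊝ s′) mf small)
  where
  open ≈-Reasoning
  f⊗[s-s′] : f ⊗ (s ⊝ s′) ≈ r′ ⊝ r
  f⊗[s-s′] = begin
    f ⊗ (s ⊝ s′)                        ≈⟨ solve 5 (λ f s s′ r r′ → f :* (s :+ :- s′) := (f :* s :+ r) :+ :- (f :* s′ :+ r) )
                                                  ≈-refl f s s′ r r′ ⟩
    (f ⊗ s ⊕ r) ⊝ (f ⊗ s′ ⊕ r)          ≈⟨ ⊕-cong e (≈-refl {negP (f ⊗ s′ ⊕ r)}) ⟩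
    (f ⊗ s′ ⊕ r′) ⊝ (f ⊗ s′ ⊕ r)        ≈⟨ solve 3 (λ fs′ r r′ → (fs′ :+ r′) :+ :- (fs′ :+ r) := r′ :+ :- r)
                                                  ≈-refl (f ⊗ s′) r r′ ⟩
    r′ ⊝ r                              ∎
  small : (f ⊗ (s ⊝ s′)) deg< n
  small j n≤j = trans (coeff-≡ f⊗[s-s′] j) (trans (coeff-⊝ r′ r j) (cong₂ ℤ._-_ (dr′ j n≤j) (dr j n≤j)))

Monic-⊗-cancelˡ : ∀ {f n} → Monic f n → ∀ {a b} → f ⊗ a ≈ f ⊗ b → a ≈ b
Monic-⊗-cancelˡ {f} mf {a} {b} e = Monic-division-unique {r = 0P} {0P} mf (λ _ _ → refl) (λ _ _ → refl)
  (≈-trans (⊕-identityʳ (f ⊗ a)) (≈-trans e (≈-sym (⊕-identityʳ (f ⊗ b)))))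

Monic-quotient : ∀ {q k p D s} → Monic q k → Monic p D → q ⊗ s ≈ p → ∃[ t ] k + t ≡ D × Monic s t
Monic-quotient {q} {k} {p} {D} {s} mq mp q⊗s≈p with leading? s
... | zeroP s≈0 = contradiction
      (trans (sym (coeff-≡ q⊗s≈p D)) (coeff-≡ (≈-trans (⊗-congˡ q s≈0) (⊗-zeroʳ q)) D))
      (Monic-leading≢0 mp)
... | leading t ds st≢0 = t , k+t≡D , ds , trans (sym top) (trans (cong (coeff p) k+t≡D) (Monic.leading mp))
  where
  top : coeff p (k + t) ≡ coeff s t
  top = trans (sym (coeff-≡ q⊗s≈p (k + t))) (Monic-⊗-leading mq ds)
  k+t≡D : k + t ≡ D
  k+t≡D = leading-unique {p} (deg<-cong q⊗s≈p (proj₁ (⊗-leading q k s t (Monic.bound mq) ds)))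
            (λ c≡0 → st≢0 (trans (sym top) c≡0)) (Monic.bound mp) (Monic-leading≢0 mp)

++≈⊕X^⊗ : ∀ xs ys → xs ++ ys ≈ xs ⊕ X^ (length xs) ⊗ ys
++≈⊕X^⊗ xs ys = ≈-trans (++≈⊕shift xs ys) (⊕-cong (≈-refl {xs}) (shift≈X^⊗ (length xs) ys))
  where
  ++≈⊕shift : ∀ xs ys → xs ++ ys ≈ xs ⊕ shift (length xs) ys
  ++≈⊕shift []       ys = ≈-refl
  ++≈⊕shift (x ∷ xs) ys = ∷-cong (sym (ℤ.+-identityʳ x)) (++≈⊕shift xs ys)

reverse-∷ : ∀ r R → reverse (r ∷ R) ≈ reverse R ⊕ X^ (length R) ⊗ const r
reverse-∷ r R = begin
  reverse (r ∷ R)                                    ≡⟨ unfold-reverse r R ⟩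
  reverse R ++ const r                               ≈⟨ ++≈⊕X^⊗ (reverse R) (const r) ⟩
  reverse R ⊕ X^ (length (reverse R)) ⊗ const r      ≡⟨ cong (λ n → reverse R ⊕ X^ n ⊗ const r) (length-reverse R) ⟩
  reverse R ⊕ X^ (length R) ⊗ const r                ∎
  where open ≈-Reasoning

length-addP : ∀ A B → length B ≤ length A → length (addP A B) ≡ length A
length-addP []      []      _        = refl
length-addP (a ∷ A) []      _        = refl
length-addP (a ∷ A) (b ∷ B) (s≤s le) = cong suc (length-addP A B le)

reverse-addP : ∀ A B → length B ≤ length A →
               reverse (addP A B) ≈ reverse A ⊕ X^ (length A ∸ length B) ⊗ reverse B
reverse-addP []      []      _ = ≈-sym (⊗-zeroʳ 1P)
reverse-addP (a ∷ A) []      _ =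
  ≈-sym (≈-trans (⊕-cong (≈-refl {reverse (a ∷ A)}) (⊗-zeroʳ (X^ (suc (length A))))) (⊕-identityʳ (reverse (a ∷ A))))
reverse-addP (a ∷ A) (b ∷ B) (s≤s le) = begin
  reverse (a ℤ.+ b ∷ addP A B)
    ≈⟨ reverse-∷ (a ℤ.+ b) (addP A B) ⟩
  reverse (addP A B) ⊕ X^ (length (addP A B)) ⊗ const (a ℤ.+ b)
    ≈⟨ ⊕-cong (reverse-addP A B le) (⊗-congʳ (const (a ℤ.+ b)) (X^-cong (length-addP A B le))) ⟩
  (reverse A ⊕ X^ d ⊗ reverse B) ⊕ X^ (length A) ⊗ (const a ⊕ const b)
    ≈⟨ solve 6 (λ rA Xd rB XA ca cb → (rA :+ Xd :* rB) :+ XA :* (ca :+ cb)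
                                 := (rA :+ XA :* ca) :+ (Xd :* rB :+ XA :* cb))
               ≈-refl (reverse A) (X^ d) (reverse B) (X^ (length A)) (const a) (const b) ⟩
  (reverse A ⊕ X^ (length A) ⊗ const a) ⊕ (X^ d ⊗ reverse B ⊕ X^ (length A) ⊗ const b)
    ≈⟨ ⊕-cong (≈-refl {reverse A ⊕ X^ (length A) ⊗ const a})
              (⊕-cong (≈-refl {X^ d ⊗ reverse B}) (⊗-congʳ (const b) (≈-sym X^d+|B|))) ⟩
  (reverse A ⊕ X^ (length A) ⊗ const a) ⊕ (X^ d ⊗ reverse B ⊕ (X^ d ⊗ X^ (length B)) ⊗ const b)
    ≈⟨ ⊕-cong (≈-refl {reverse A ⊕ X^ (length A) ⊗ const a})
              (solve 4 (λ Xd rB XB cb → Xd :* rB :+ (Xd :* XB) :* cb := Xd :* (rB :+ XB :* cb))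
                     ≈-refl (X^ d) (reverse B) (X^ (length B)) (const b)) ⟩
  (reverse A ⊕ X^ (length A) ⊗ const a) ⊕ X^ d ⊗ (reverse B ⊕ X^ (length B) ⊗ const b)
    ≈⟨ ⊕-cong (≈-sym (reverse-∷ a A)) (⊗-congˡ (X^ d) (≈-sym (reverse-∷ b B))) ⟩
  reverse (a ∷ A) ⊕ X^ d ⊗ reverse (b ∷ B) ∎
  where
  open ≈-Reasoning
  d : ℕ
  d = length A ∸ length B
  X^d+|B| : X^ d ⊗ X^ (length B) ≈ X^ (length A)
  X^d+|B| = ≈-trans (X^-+ d (length B)) (X^-cong (ℕ.m∸n+n≡m le))

length-divRev : ∀ t R Q → length (divRev t R Q) ≡ t
length-divRev zero    R       Q = refl
length-divRev (suc t) []      Q = cong suc (length-divRev t [] Q)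
length-divRev (suc t) (r ∷ R) Q = cong suc (length-divRev t _ Q)

-- `divRev` works on coefficient lists written highest degree first, hence the `reverse`s.
divRev-correct : ∀ Q′ t R → length R ≡ t + length Q′ →
  ∃[ rem ] length rem ≡ length Q′ ×
           reverse R ≈ reverse (+ 1 ∷ Q′) ⊗ reverse (divRev t R (+ 1 ∷ Q′)) ⊕ reverse rem
divRev-correct Q′ zero R |R| = R , |R| , ≈-sym (⊕-cong (⊗-zeroʳ (reverse (+ 1 ∷ Q′))) (≈-refl {reverse R}))
divRev-correct Q′ (suc t) (r ∷ R₀) |R| = step (divRev-correct Q′ t R′ |R′|)
  where
  open ≈-Reasoning
  k : ℕ
  k = length Q′
  Q B R′ O : List ℤ
  Q  = + 1 ∷ Q′
  B  = map (λ c → ℤ.- (r ℤ.* c)) Q′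
  R′ = addP R₀ B
  O  = divRev t R′ Q
  |R₀| : length R₀ ≡ t + k
  |R₀| = ℕ.suc-injective |R|
  |B|≤|R₀| : length B ≤ length R₀
  |B|≤|R₀| = ℕ.≤-trans (ℕ.≤-reflexive (length-map _ Q′)) (ℕ.≤-trans (ℕ.m≤n+m k t) (ℕ.≤-reflexive (sym |R₀|)))
  |R′| : length R′ ≡ t + k
  |R′| = trans (length-addP R₀ B |B|≤|R₀|) |R₀|
  X^|R₀| : X^ (length R₀) ≈ X^ t ⊗ X^ k
  X^|R₀| = ≈-trans (X^-cong |R₀|) (≈-sym (X^-+ t k))
  B≈ : ∀ L → map (λ c → ℤ.- (r ℤ.* c)) L ≈ negP (r · L)
  B≈ []      = ≈-refl
  B≈ (x ∷ L) = ∷-cong refl (B≈ L)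
  reverse-B : reverse B ≈ negP (const r ⊗ reverse Q′)
  reverse-B = begin
    reverse B                       ≡⟨ reverse-map _ Q′ ⟨
    map (λ c → ℤ.- (r ℤ.* c)) (reverse Q′) ≈⟨ B≈ (reverse Q′) ⟩
    negP (r · reverse Q′)           ≈⟨ negP-cong (const-⊗ r (reverse Q′)) ⟨
    negP (const r ⊗ reverse Q′)     ∎
  |R₀|∸|B| : length R₀ ∸ length B ≡ t
  |R₀|∸|B| = trans (cong₂ _∸_ |R₀| (length-map _ Q′)) (ℕ.m+n∸n≡m t k)
  reverse-R′ : reverse R′ ≈ reverse R₀ ⊕ X^ t ⊗ negP (const r ⊗ reverse Q′)
  reverse-R′ = ≈-trans (reverse-addP R₀ B |B|≤|R₀|)
                       (⊕-cong (≈-refl {reverse R₀}) (⊗-cong (X^-cong |R₀|∸|B|) reverse-B))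
  reverse-Q : reverse Q ≈ reverse Q′ ⊕ X^ k
  reverse-Q = ≈-trans (reverse-∷ (+ 1) Q′) (⊕-cong (≈-refl {reverse Q′}) (⊗-identityʳ (X^ k)))
  reverse-r∷O : reverse (r ∷ O) ≈ reverse O ⊕ X^ t ⊗ const r
  reverse-r∷O = ≈-trans (reverse-∷ r O) (⊕-cong (≈-refl {reverse O}) (⊗-congʳ (const r) (X^-cong (length-divRev t R′ Q))))
  step : ∃[ rem ] length rem ≡ k × reverse R′ ≈ reverse Q ⊗ reverse O ⊕ reverse rem →
         ∃[ rem ] length rem ≡ k × reverse (r ∷ R₀) ≈ reverse Q ⊗ reverse (r ∷ O) ⊕ reverse rem
  step (rem , |rem| , ih) = rem , |rem| , (begin
    reverse (r ∷ R₀)                                         ≈⟨ reverse-∷ r R₀ ⟩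
    reverse R₀ ⊕ X^ (length R₀) ⊗ const r                    ≈⟨ ⊕-cong (≈-refl {reverse R₀}) (⊗-congʳ (const r) X^|R₀|) ⟩
    reverse R₀ ⊕ (X^ t ⊗ X^ k) ⊗ const r
      ≈⟨ solve 5 (λ R₀ Xt Xk cr Q′ → R₀ :+ (Xt :* Xk) :* cr
                                 := (R₀ :+ Xt :* (:- (cr :* Q′))) :+ (Q′ :+ Xk) :* (Xt :* cr))
                 ≈-refl (reverse R₀) (X^ t) (X^ k) (const r) (reverse Q′) ⟩
    (reverse R₀ ⊕ X^ t ⊗ negP (const r ⊗ reverse Q′)) ⊕ (reverse Q′ ⊕ X^ k) ⊗ (X^ t ⊗ const r)
      ≈⟨ ⊕-cong (≈-trans (≈-sym reverse-R′) ih) (⊗-congʳ (X^ t ⊗ const r) (≈-sym reverse-Q)) ⟩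
    (reverse Q ⊗ reverse O ⊕ reverse rem) ⊕ reverse Q ⊗ (X^ t ⊗ const r)
      ≈⟨ solve 4 (λ Q O rem M → (Q :* O :+ rem) :+ Q :* M := Q :* (O :+ M) :+ rem)
                 ≈-refl (reverse Q) (reverse O) (reverse rem) (X^ t ⊗ const r) ⟩
    reverse Q ⊗ (reverse O ⊕ X^ t ⊗ const r) ⊕ reverse rem
      ≈⟨ ⊕-cong (⊗-congˡ (reverse Q) (≈-sym reverse-r∷O)) (≈-refl {reverse rem}) ⟩
    reverse Q ⊗ reverse (r ∷ O) ⊕ reverse rem                ∎)

divide : ∀ {f n} → Monic f n → ∀ a → ∃₂ λ o r → r deg< n × a ≈ f ⊗ o ⊕ r
divide {f} {n} mf a with Monic-stripZeros mf | n ℕ.≤? length a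
... | Q′ , eq , |Q′| | no n≰|a| =
  0P , a , deg<-mono {a} (ℕ.<⇒≤ (ℕ.≰⇒> n≰|a|)) (deg<-length a) ,
  ≈-sym (⊕-cong (⊗-zeroʳ f) (≈-refl {a}))
... | Q′ , eq , |Q′| | yes n≤|a|
  with divRev-correct Q′ (length a ∸ n) (reverse a)
         (trans (length-reverse a) (trans (sym (ℕ.m∸n+n≡m n≤|a|)) (cong (_+_ (length a ∸ n)) (sym |Q′|))))
...   | rem , |rem| , a≈ =
  reverse (divRev (length a ∸ n) (reverse a) (+ 1 ∷ Q′)) , reverse rem ,
  deg<-mono {reverse rem} (ℕ.≤-reflexive (trans (length-reverse rem) (trans |rem| |Q′|))) (deg<-length (reverse rem)) ,
  ≈-trans (≈-reflexive (sym (reverse-involutive a)))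
          (≈-trans a≈ (⊕-cong (⊗-congʳ _ (stripZeros-reverse-≈ f eq)) ≈-refl))

divMonic-≈ : ∀ {q k p D s} → Monic q k → Monic p D → q ⊗ s ≈ p → divMonic p q ≈ s
divMonic-≈ {q} {k} {p} {D} {s} mq mp q⊗s≈p
  with Monic-stripZeros mq | Monic-stripZeros mp | Monic-quotient mq mp q⊗s≈p
... | Q′ , eqQ , |Q′| | P′ , eqP , |P′| | t , k+t≡D , _
  with divRev-correct Q′ (suc t) (+ 1 ∷ P′) |P|
  where
  |P| : suc (length P′) ≡ suc t + length Q′
  |P| = cong suc (trans |P′| (trans (sym k+t≡D) (trans (ℕ.+-comm k t) (cong (_+_ t) (sym |Q′|)))))
... | rem , |rem| , P≈ = begin
  divMonic p q                          ≡⟨ cong₂ (λ P Q → normalize (reverse (divRev (suc (length P) ∸ length Q) P Q))) eqP eqQ ⟩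
  normalize (reverse (divRev (suc (suc (length P′)) ∸ suc (length Q′)) (+ 1 ∷ P′) (+ 1 ∷ Q′)))
                                        ≡⟨ cong (λ u → normalize (reverse (divRev u (+ 1 ∷ P′) (+ 1 ∷ Q′)))) u≡suc-t ⟩
  normalize (reverse O)                 ≈⟨ normalize-≈ (reverse O) ⟩
  reverse O                             ≈⟨ Monic-division-unique mq (λ _ _ → refl) rem-small q⊗s≈q⊗O+rem ⟨
  s                                     ∎
  where
  open ≈-Reasoning
  O : List ℤ
  O = divRev (suc t) (+ 1 ∷ P′) (+ 1 ∷ Q′)
  u≡suc-t : suc (length P′) ∸ length Q′ ≡ suc t
  u≡suc-t = trans (cong₂ (λ a b → suc a ∸ b) |P′| |Q′|)
              (trans (cong (λ d → suc d ∸ k) (sym k+t≡D)) (trans (ℕ.+-∸-assoc 1 (ℕ.m≤m+n k t)) (cong suc (ℕ.m+n∸m≡n k t))))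
  rem-small : reverse rem deg< k
  rem-small = deg<-mono {reverse rem} (ℕ.≤-reflexive (trans (length-reverse rem) (trans |rem| |Q′|)))
                        (deg<-length (reverse rem))
  q⊗s≈q⊗O+rem : q ⊗ s ⊕ 0P ≈ q ⊗ reverse O ⊕ reverse rem
  q⊗s≈q⊗O+rem = begin
    q ⊗ s ⊕ 0P                                    ≈⟨ ⊕-identityʳ (q ⊗ s) ⟩
    q ⊗ s                                         ≈⟨ q⊗s≈p ⟩
    p                                             ≈⟨ stripZeros-reverse-≈ p eqP ⟨
    reverse (+ 1 ∷ P′)                            ≈⟨ P≈ ⟩
    reverse (+ 1 ∷ Q′) ⊗ reverse O ⊕ reverse rem  ≈⟨ ⊕-cong (⊗-congʳ (reverse O) (stripZeros-reverse-≈ q eqQ)) (≈-refl {reverse rem}) ⟩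
    q ⊗ reverse O ⊕ reverse rem                   ∎

-- Divisibility, ideals and X^n − 1

infix 4 _∣ₚ_
_∣ₚ_ : Poly → Poly → Set
f ∣ₚ g = ∃[ h ] f ⊗ h ≈ g

∣ₚ-trans : ∀ {f g h} → f ∣ₚ g → g ∣ₚ h → f ∣ₚ h
∣ₚ-trans {f} (a , fa≈g) (b , gb≈h) = a ⊗ b , ≈-trans (≈-sym (⊗-assoc f a b)) (≈-trans (⊗-congʳ b fa≈g) gb≈h)

∣ₚ-respˡ : ∀ {f g h} → f ≈ g → f ∣ₚ h → g ∣ₚ h
∣ₚ-respˡ {f} {g} f≈g (a , fa≈h) = a , ≈-trans (⊗-congʳ a (≈-sym f≈g)) fa≈h

∣ₚ-respʳ : ∀ {f g h} → g ≈ h → f ∣ₚ g → f ∣ₚ h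
∣ₚ-respʳ g≈h (a , fa≈g) = a , ≈-trans fa≈g g≈h

·-deg< : ∀ c {r n} → r deg< n → c · r deg< n
·-deg< c {r} dr j n≤j = trans (coeff-· c r j) (trans (cong (c ℤ.*_) (dr j n≤j)) (ℤ.*-zeroʳ c))

·-cancel-≈0 : ∀ {c r} → c ≢ + 0 → c · r ≈ 0P → r ≈ 0P
·-cancel-≈0 {c} {r} c≢0 e = mk≈ λ j →
  [ flip contradiction c≢0 , id ]′ (ℤ.i*j≡0⇒i≡0∨j≡0 c (trans (sym (coeff-· c r j)) (coeff-≡ e j)))

*-≢0 : ∀ {c d} → c ≢ + 0 → d ≢ + 0 → c ℤ.* d ≢ + 0
*-≢0 {c} c≢0 d≢0 cd≡0 = [ c≢0 , d≢0 ]′ (ℤ.i*j≡0⇒i≡0∨j≡0 c cd≡0)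

pos≢0 : ∀ {d} → 1 ≤ d → + d ≢ + 0
pos≢0 (s≤s _) ()

-- Division with remainder by f shows that f ∣ c·a forces the remainder of a to vanish.
Monic-∣-· : ∀ {f n c a} → Monic f n → c ≢ + 0 → f ∣ₚ c · a → f ∣ₚ a
Monic-∣-· {f} {n} {c} {a} mf c≢0 (w , fw≈ca) with divide mf a
... | o , r , dr , a≈ = o , ≈-sym (≈-trans a≈ (≈-trans (⊕-cong (≈-refl {f ⊗ o}) (·-cancel-≈0 c≢0 cr≈0)) (⊕-identityʳ (f ⊗ o))))
  where
  open ≈-Reasoning
  ca≈ : c · a ≈ f ⊗ (c · o) ⊕ c · r
  ca≈ = begin
    c · a                     ≈⟨ ·-congˡ c a≈ ⟩
    c · (f ⊗ o ⊕ r)           ≈⟨ ·-distribˡ-⊕ c (f ⊗ o) r ⟩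
    c · (f ⊗ o) ⊕ c · r       ≈⟨ ⊕-cong (≈-sym (⊗-· c f o)) (≈-refl {c · r}) ⟩
    f ⊗ (c · o) ⊕ c · r       ∎
  w≈co : w ≈ c · o
  w≈co = Monic-division-unique mf (λ _ _ → refl) (·-deg< c {r} dr) (≈-trans (⊕-identityʳ (f ⊗ w)) (≈-trans fw≈ca ca≈))
  cr≈0 : c · r ≈ 0P
  cr≈0 = begin
    c · r                                 ≈⟨ solve 2 (λ x y → y := (x :+ y) :+ :- x) ≈-refl (f ⊗ (c · o)) (c · r) ⟩
    (f ⊗ (c · o) ⊕ c · r) ⊝ f ⊗ (c · o)   ≈⟨ ⊕-cong (≈-sym ca≈) (≈-refl {negP (f ⊗ (c · o))}) ⟩
    c · a ⊝ f ⊗ (c · o)                   ≈⟨ ⊕-cong (≈-sym fw≈ca) (negP-cong (⊗-congˡ f (≈-sym w≈co))) ⟩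
    f ⊗ w ⊝ f ⊗ w                         ≈⟨ ⊕-inverseʳ (f ⊗ w) ⟩
    0P                                    ∎

infix 4 _∈⟨_,_⟩
record _∈⟨_,_⟩ (r f g : Poly) : Set where
  constructor combination
  field
    u v : Poly
    u⊗f⊕v⊗g≈r : u ⊗ f ⊕ v ⊗ g ≈ r

∈⟨⟩-swap : ∀ {r f g} → r ∈⟨ f , g ⟩ → r ∈⟨ g , f ⟩
∈⟨⟩-swap {f = f} {g} (combination u v e) = combination v u (≈-trans (⊕-comm (v ⊗ g) (u ⊗ f)) e)

∈⟨⟩-trans : ∀ {r f g h} → r ∈⟨ f , g ⟩ → g ∈⟨ f , h ⟩ → r ∈⟨ f , h ⟩
∈⟨⟩-trans {f = f} {g} {h} (combination u v e) (combination A B eg) =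
  combination (u ⊕ v ⊗ A) (v ⊗ B) (begin
    (u ⊕ v ⊗ A) ⊗ f ⊕ (v ⊗ B) ⊗ h  ≈⟨ solve 6 (λ u v A f B h → (u :+ v :* A) :* f :+ (v :* B) :* h
                                                          := u :* f :+ v :* (A :* f :+ B :* h)) ≈-refl u v A f B h ⟩
    u ⊗ f ⊕ v ⊗ (A ⊗ f ⊕ B ⊗ h)    ≈⟨ ⊕-cong (≈-refl {u ⊗ f}) (⊗-congˡ v eg) ⟩
    u ⊗ f ⊕ v ⊗ g                  ≈⟨ e ⟩
    _                              ∎)
  where open ≈-Reasoning

const-∈⟨⟩-⊗ : ∀ {c d f g h} → const c ∈⟨ f , g ⟩ → const d ∈⟨ f , h ⟩ → const (c ℤ.* d) ∈⟨ f , g ⊗ h ⟩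
const-∈⟨⟩-⊗ {c} {d} {f} {g} {h} (combination u v e) (combination u′ v′ e′) =
  combination (u ⊗ (u′ ⊗ f ⊕ v′ ⊗ h) ⊕ (v ⊗ g) ⊗ u′) (v ⊗ v′) (begin
    (u ⊗ (u′ ⊗ f ⊕ v′ ⊗ h) ⊕ (v ⊗ g) ⊗ u′) ⊗ f ⊕ (v ⊗ v′) ⊗ (g ⊗ h)
      ≈⟨ solve 7 (λ u u′ f v′ h v g → (u :* (u′ :* f :+ v′ :* h) :+ (v :* g) :* u′) :* f :+ (v :* v′) :* (g :* h)
                                    := (u :* f :+ v :* g) :* (u′ :* f :+ v′ :* h)) ≈-refl u u′ f v′ h v g ⟩
    (u ⊗ f ⊕ v ⊗ g) ⊗ (u′ ⊗ f ⊕ v′ ⊗ h)  ≈⟨ ⊗-cong e e′ ⟩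
    const c ⊗ const d                     ≈⟨ ≈-trans (const-⊗ c (const d)) (∷-cong refl ≈-refl) ⟩
    const (c ℤ.* d)                       ∎)
  where open ≈-Reasoning

Monic-∈⟨⟩-∣ : ∀ {f n g c} → Monic f n → c ≢ + 0 → const c ∈⟨ f , g ⟩ → ∀ a → f ∣ₚ g ⊗ a → f ∣ₚ a
Monic-∈⟨⟩-∣ {f} {n} {g} {c} mf c≢0 (combination u v e) a (k , fk≈ga) =
  Monic-∣-· mf c≢0 (u ⊗ a ⊕ v ⊗ k , (begin
    f ⊗ (u ⊗ a ⊕ v ⊗ k)        ≈⟨ solve 5 (λ f u a v k → f :* (u :* a :+ v :* k) := (u :* f) :* a :+ v :* (f :* k)) ≈-refl f u a v k ⟩
    (u ⊗ f) ⊗ a ⊕ v ⊗ (f ⊗ k)  ≈⟨ ⊕-cong (≈-refl {(u ⊗ f) ⊗ a}) (⊗-congˡ v fk≈ga) ⟩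
    (u ⊗ f) ⊗ a ⊕ v ⊗ (g ⊗ a)  ≈⟨ solve 5 (λ f u a v g → (u :* f) :* a :+ v :* (g :* a) := (u :* f :+ v :* g) :* a) ≈-refl f u a v g ⟩
    (u ⊗ f ⊕ v ⊗ g) ⊗ a        ≈⟨ ⊗-congʳ a e ⟩
    const c ⊗ a                ≈⟨ const-⊗ c a ⟩
    c · a                      ∎))
  where open ≈-Reasoning

-- The Euler operator θ = X·d/dX.
θ : Poly → Poly
θ []      = []
θ (a ∷ p) = + 0 ∷ (θ p ⊕ p)

coeff-θ : ∀ p j → coeff (θ p) j ≡ + j ℤ.* coeff p j
coeff-θ []      j       = sym (ℤ.*-zeroʳ (+ j))
coeff-θ (a ∷ p) zero    = sym (ℤ.*-zeroˡ a)
coeff-θ (a ∷ p) (suc j) = begin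
  coeff (θ p ⊕ p) j                      ≡⟨ coeff-⊕ (θ p) p j ⟩
  coeff (θ p) j ℤ.+ coeff p j            ≡⟨ cong (ℤ._+ coeff p j) (coeff-θ p j) ⟩
  + j ℤ.* coeff p j ℤ.+ coeff p j        ≡⟨ distrib (+ j) (coeff p j) ⟩
  + suc j ℤ.* coeff p j                  ∎
  where
  open ≡-Reasoning
  distrib : ∀ (x y : ℤ) → x ℤ.* y ℤ.+ y ≡ (+ 1 ℤ.+ x) ℤ.* y
  distrib = ℤ.solve-∀

θ-cong : ∀ {p q} → p ≈ q → θ p ≈ θ q
θ-cong {p} {q} e = mk≈ λ j → trans (coeff-θ p j) (trans (cong (+ j ℤ.*_) (coeff-≡ e j)) (sym (coeff-θ q j)))

θ-⊕ : ∀ p q → θ (p ⊕ q) ≈ θ p ⊕ θ q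
θ-⊕ p q = mk≈ λ j → begin
  coeff (θ (p ⊕ q)) j                          ≡⟨ coeff-θ (p ⊕ q) j ⟩
  + j ℤ.* coeff (p ⊕ q) j                      ≡⟨ cong (+ j ℤ.*_) (coeff-⊕ p q j) ⟩
  + j ℤ.* (coeff p j ℤ.+ coeff q j)            ≡⟨ ℤ.*-distribˡ-+ (+ j) _ _ ⟩
  + j ℤ.* coeff p j ℤ.+ + j ℤ.* coeff q j      ≡⟨ cong₂ ℤ._+_ (coeff-θ p j) (coeff-θ q j) ⟨
  coeff (θ p) j ℤ.+ coeff (θ q) j              ≡⟨ coeff-⊕ (θ p) (θ q) j ⟨
  coeff (θ p ⊕ θ q) j                          ∎
  where open ≡-Reasoning

θ-· : ∀ a p → θ (a · p) ≈ a · θ p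
θ-· a p = mk≈ λ j → begin
  coeff (θ (a · p)) j          ≡⟨ coeff-θ (a · p) j ⟩
  + j ℤ.* coeff (a · p) j      ≡⟨ cong (+ j ℤ.*_) (coeff-· a p j) ⟩
  + j ℤ.* (a ℤ.* coeff p j)    ≡⟨ swap (+ j) a (coeff p j) ⟩
  a ℤ.* (+ j ℤ.* coeff p j)    ≡⟨ cong (a ℤ.*_) (coeff-θ p j) ⟨
  a ℤ.* coeff (θ p) j          ≡⟨ coeff-· a (θ p) j ⟨
  coeff (a · θ p) j            ∎
  where
  open ≡-Reasoning
  swap : ∀ (x y z : ℤ) → x ℤ.* (y ℤ.* z) ≡ y ℤ.* (x ℤ.* z)
  swap = ℤ.solve-∀

θ-⊗ : ∀ p q → θ (p ⊗ q) ≈ θ p ⊗ q ⊕ p ⊗ θ q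
θ-⊗ []      q = ≈-refl
θ-⊗ (a ∷ p) q = begin
  θ (a · q ⊕ (+ 0 ∷ p ⊗ q))
    ≈⟨ θ-⊕ (a · q) (+ 0 ∷ p ⊗ q) ⟩
  θ (a · q) ⊕ (+ 0 ∷ (θ (p ⊗ q) ⊕ p ⊗ q))
    ≈⟨ ⊕-cong (≈-trans (θ-· a q) (≈-sym (const-⊗ a (θ q))))
              (≈-trans (∷-cong refl (⊕-cong (θ-⊗ p q) (≈-refl {p ⊗ q}))) (shift≈X^⊗ 1 _)) ⟩
  const a ⊗ θ q ⊕ X^ 1 ⊗ ((θ p ⊗ q ⊕ p ⊗ θ q) ⊕ p ⊗ q)
    ≈⟨ solve 6 (λ A θq X θp q p → A :* θq :+ X :* ((θp :* q :+ p :* θq) :+ p :* q)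
                               := (X :* (θp :+ p)) :* q :+ (A :+ X :* p) :* θq)
               ≈-refl (const a) (θ q) (X^ 1) (θ p) q p ⟩
  (X^ 1 ⊗ (θ p ⊕ p)) ⊗ q ⊕ (const a ⊕ X^ 1 ⊗ p) ⊗ θ q
    ≈⟨ ⊕-cong (⊗-congʳ q (≈-sym (shift≈X^⊗ 1 (θ p ⊕ p)))) (⊗-congʳ (θ q) (≈-sym (∷≈const⊕X⊗ a p))) ⟩
  θ (a ∷ p) ⊗ q ⊕ (a ∷ p) ⊗ θ q ∎
  where open ≈-Reasoning

θ-X^ : ∀ n → θ (X^ n) ≈ (+ n) · X^ n
θ-X^ n = mk≈ λ j → trans (coeff-θ (X^ n) j) (trans (only-at-n j) (sym (coeff-· (+ n) (X^ n) j)))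
  where
  only-at-n : ∀ j → + j ℤ.* coeff (X^ n) j ≡ + n ℤ.* coeff (X^ n) j
  only-at-n j with j ℕ.≟ n
  ... | yes refl = refl
  ... | no j≢n rewrite coeff-X^-≢ n j≢n = trans (ℤ.*-zeroʳ (+ j)) (sym (ℤ.*-zeroʳ (+ n)))

θ-X^-1 : ∀ n → θ (X^ n ⊝ 1P) ⊝ const (+ n) ⊗ (X^ n ⊝ 1P) ≈ const (+ n)
θ-X^-1 n = begin
  θ (X^ n ⊝ 1P) ⊝ N ⊗ (X^ n ⊝ 1P)                ≈⟨ ⊕-cong θ[X^n-1] (≈-refl {negP (N ⊗ (X^ n ⊝ 1P))}) ⟩
  N ⊗ X^ n ⊝ N ⊗ (X^ n ⊝ 1P)                     ≈⟨ solve 2 (λ N X → N :* X :+ :- (N :* (X :+ :- Κ 1P)) := N :* Κ 1P) ≈-refl N (X^ n) ⟩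
  N ⊗ 1P                                          ≈⟨ ⊗-identityʳ N ⟩
  N                                               ∎
  where
  open ≈-Reasoning
  N : Poly
  N = const (+ n)
  θ[X^n-1] : θ (X^ n ⊝ 1P) ≈ N ⊗ X^ n
  θ[X^n-1] = begin
    θ (X^ n ⊝ 1P)              ≈⟨ θ-⊕ (X^ n) (negP 1P) ⟩
    θ (X^ n) ⊕ θ (negP 1P)     ≈⟨ ⊕-cong (θ-X^ n) (0∷-≈0 ≈-refl) ⟩
    (+ n) · X^ n ⊕ 0P          ≈⟨ ⊕-identityʳ ((+ n) · X^ n) ⟩
    (+ n) · X^ n               ≈⟨ const-⊗ (+ n) (X^ n) ⟨
    N ⊗ X^ n                   ∎

-- θ(f g a) − n f g a = θ(X^n − 1) − n (X^n − 1) = n, and the left side is a combination of f and g.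
X^-1-factors-coprime : ∀ n f g a → f ⊗ (g ⊗ a) ≈ X^ n ⊝ 1P → const (+ n) ∈⟨ f , g ⟩
X^-1-factors-coprime n f g a e = combination (θ (g ⊗ a) ⊝ N ⊗ (g ⊗ a)) (θ f ⊗ a) (begin
  (θ (g ⊗ a) ⊝ N ⊗ (g ⊗ a)) ⊗ f ⊕ (θ f ⊗ a) ⊗ g
    ≈⟨ solve 6 (λ θga N g a f θf → (θga :+ :- (N :* (g :* a))) :* f :+ (θf :* a) :* g
                                := (θf :* (g :* a) :+ f :* θga) :+ :- (N :* (f :* (g :* a))))
               ≈-refl (θ (g ⊗ a)) N g a f (θ f) ⟩
  (θ f ⊗ (g ⊗ a) ⊕ f ⊗ θ (g ⊗ a)) ⊝ N ⊗ (f ⊗ (g ⊗ a))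
    ≈⟨ ⊕-cong (≈-sym (θ-⊗ f (g ⊗ a))) (≈-refl {negP (N ⊗ (f ⊗ (g ⊗ a)))}) ⟩
  θ (f ⊗ (g ⊗ a)) ⊝ N ⊗ (f ⊗ (g ⊗ a))
    ≈⟨ ⊕-cong (θ-cong e) (negP-cong (⊗-congˡ N e)) ⟩
  θ (X^ n ⊝ 1P) ⊝ N ⊗ (X^ n ⊝ 1P)
    ≈⟨ θ-X^-1 n ⟩
  N ∎)
  where
  open ≈-Reasoning
  N : Poly
  N = const (+ n)

X^-1∣X^*-1 : ∀ k a → X^ a ⊝ 1P ∣ₚ X^ (k * a) ⊝ 1P
X^-1∣X^*-1 zero    a = 0P , ≈-trans (⊗-zeroʳ (X^ a ⊝ 1P)) (≈-sym (⊕-inverseʳ 1P))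
X^-1∣X^*-1 (suc k) a with X^-1∣X^*-1 k a
... | G , eG = X^ (k * a) ⊕ G , (begin
  (X^ a ⊝ 1P) ⊗ (X^ (k * a) ⊕ G)                   ≈⟨ ⊗-distribˡ-⊕ (X^ a ⊝ 1P) (X^ (k * a)) G ⟩
  (X^ a ⊝ 1P) ⊗ X^ (k * a) ⊕ (X^ a ⊝ 1P) ⊗ G       ≈⟨ ⊕-cong (≈-refl {(X^ a ⊝ 1P) ⊗ X^ (k * a)}) eG ⟩
  (X^ a ⊝ 1P) ⊗ X^ (k * a) ⊕ (X^ (k * a) ⊝ 1P)     ≈⟨ solve 2 (λ A K → (A :+ :- Κ 1P) :* K :+ (K :+ :- Κ 1P) := A :* K :+ :- Κ 1P)
                                                               ≈-refl (X^ a) (X^ (k * a)) ⟩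
  X^ a ⊗ X^ (k * a) ⊝ 1P                           ≈⟨ ⊕-cong (X^-+ a (k * a)) (≈-refl {negP 1P}) ⟩
  X^ (suc k * a) ⊝ 1P                              ∎)
  where open ≈-Reasoning

X^-1-∈⟨⟩ : ∀ g d e x y → g + y * e ≡ x * d → X^ g ⊝ 1P ∈⟨ X^ d ⊝ 1P , X^ e ⊝ 1P ⟩
X^-1-∈⟨⟩ g d e x y g+ye≡xd with X^-1∣X^*-1 x d | X^-1∣X^*-1 y e
... | G₁ , e₁ | G₂ , e₂ = combination G₁ (negP (X^ g ⊗ G₂)) (begin
  G₁ ⊗ Yd ⊕ negP (X^ g ⊗ G₂) ⊗ Ye
    ≈⟨ solve 5 (λ G₁ Yd Xg G₂ Ye → G₁ :* Yd :+ (:- (Xg :* G₂)) :* Ye := Yd :* G₁ :+ :- (Xg :* (Ye :* G₂)))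
               ≈-refl G₁ Yd (X^ g) G₂ Ye ⟩
  Yd ⊗ G₁ ⊝ X^ g ⊗ (Ye ⊗ G₂)
    ≈⟨ ⊕-cong e₁ (negP-cong (⊗-congˡ (X^ g) e₂)) ⟩
  (X^ (x * d) ⊝ 1P) ⊝ X^ g ⊗ (X^ (y * e) ⊝ 1P)
    ≈⟨ ⊕-cong (⊕-cong (≈-trans (X^-cong (sym g+ye≡xd)) (≈-sym (X^-+ g (y * e)))) (≈-refl {negP 1P}))
              (≈-refl {negP (X^ g ⊗ (X^ (y * e) ⊝ 1P))}) ⟩
  (X^ g ⊗ X^ (y * e) ⊝ 1P) ⊝ X^ g ⊗ (X^ (y * e) ⊝ 1P)
    ≈⟨ solve 2 (λ G K → (G :* K :+ :- Κ 1P) :+ :- (G :* (K :+ :- Κ 1P)) := G :+ :- Κ 1P) ≈-refl (X^ g) (X^ (y * e)) ⟩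
  X^ g ⊝ 1P ∎)
  where
  open ≈-Reasoning
  Yd Ye : Poly
  Yd = X^ d ⊝ 1P
  Ye = X^ e ⊝ 1P

X^gcd-1-∈⟨⟩ : ∀ d e → ∃[ g ] GCD d e g × X^ g ⊝ 1P ∈⟨ X^ d ⊝ 1P , X^ e ⊝ 1P ⟩
X^gcd-1-∈⟨⟩ d e with Bézout.lemma d e
... | Bézout.result g G (Bézout.+- x y eq) = g , G , X^-1-∈⟨⟩ g d e x y eq
... | Bézout.result g G (Bézout.-+ x y eq) = g , G , ∈⟨⟩-swap (X^-1-∈⟨⟩ g e d y x eq)

∈⟨⟩-∣ : ∀ {r f f′ g g′} → f ∣ₚ f′ → g ∣ₚ g′ → r ∈⟨ f′ , g′ ⟩ → r ∈⟨ f , g ⟩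
∈⟨⟩-∣ {f = f} {f′} {g} {g′} (a , fa≈f′) (b , gb≈g′) (combination u v e) = combination (u ⊗ a) (v ⊗ b) (begin
  (u ⊗ a) ⊗ f ⊕ (v ⊗ b) ⊗ g   ≈⟨ solve 6 (λ u a f v b g → (u :* a) :* f :+ (v :* b) :* g := u :* (f :* a) :+ v :* (g :* b))
                                         ≈-refl u a f v b g ⟩
  u ⊗ (f ⊗ a) ⊕ v ⊗ (g ⊗ b)   ≈⟨ ⊕-cong (⊗-congˡ u fa≈f′) (⊗-congˡ v gb≈g′) ⟩
  u ⊗ f′ ⊕ v ⊗ g′             ≈⟨ e ⟩
  _                           ∎)
  where open ≈-Reasoning

const-1-∈⟨⟩ : ∀ f → const (+ 1) ∈⟨ f , 1P ⟩
const-1-∈⟨⟩ f = combination 0P 1P (⊗-identityˡ 1P)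

Monic-X^-1 : ∀ n → 1 ≤ n → Monic (X^ n ⊝ 1P) n
Monic-X^-1 (suc n) _ = bounded , trans (coeff-⊝ (X^ (suc n)) 1P (suc n)) (cong (ℤ._- + 0) (coeff-X^-≡ n))
  where
  bounded : X^ (suc n) ⊝ 1P deg≤ suc n
  bounded (suc j) (s≤s n<j) = trans (coeff-⊝ (X^ (suc n)) 1P (suc j)) (cong (ℤ._- + 0) (coeff-X^-≢ n (ℕ.>⇒≢ n<j)))

-- X^m − 1 = ∏_{d ∣ m} Φ_d

∏ : (ℕ → Poly) → List ℕ → Poly
∏ φ []       = 1P
∏ φ (x ∷ xs) = φ x ⊗ ∏ φ xs

foldr-⊗-map : ∀ φ xs → foldr mulP 1P (map φ xs) ≡ ∏ φ xs
foldr-⊗-map φ []       = refl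
foldr-⊗-map φ (x ∷ xs) = cong (φ x ⊗_) (foldr-⊗-map φ xs)

∏-cong : ∀ {φ ψ} xs → (∀ {x} → x ∈ xs → φ x ≈ ψ x) → ∏ φ xs ≈ ∏ ψ xs
∏-cong []       φ≈ψ = ≈-refl
∏-cong (x ∷ xs) φ≈ψ = ⊗-cong (φ≈ψ (here refl)) (∏-cong xs (φ≈ψ ∘ there))

∏-++ : ∀ φ xs ys → ∏ φ (xs ++ ys) ≈ ∏ φ xs ⊗ ∏ φ ys
∏-++ φ []       ys = ≈-sym (⊗-identityˡ _)
∏-++ φ (x ∷ xs) ys = ≈-trans (⊗-congˡ (φ x) (∏-++ φ xs ys)) (≈-sym (⊗-assoc (φ x) _ _))

∏-↭ : ∀ φ {xs ys} → xs ↭ ys → ∏ φ xs ≈ ∏ φ ys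
∏-↭ φ ↭.refl                       = ≈-refl
∏-↭ φ (↭.prep x xs↭ys)               = ⊗-congˡ (φ x) (∏-↭ φ xs↭ys)
∏-↭ φ (↭.swap {xs} {ys} x y xs↭ys)   = ≈-trans (⊗-congˡ (φ x) (⊗-congˡ (φ y) (∏-↭ φ xs↭ys)))
  (solve 3 (λ a b c → a :* (b :* c) := b :* (a :* c)) ≈-refl (φ x) (φ y) (∏ φ ys))
∏-↭ φ (↭.trans xs↭ys ys↭zs)          = ≈-trans (∏-↭ φ xs↭ys) (∏-↭ φ ys↭zs)

∏-filter : ∀ φ {P : ℕ → Set} (P? : Decidable P) xs →
           ∏ φ xs ≈ ∏ φ (filter P? xs) ⊗ ∏ φ (filter (¬? ∘ P?) xs)
∏-filter φ P? []       = ≈-sym (⊗-identityˡ 1P)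
∏-filter φ P? (x ∷ xs) with P? x
... | yes _ = ≈-trans (⊗-congˡ (φ x) (∏-filter φ P? xs)) (≈-sym (⊗-assoc (φ x) _ _))
... | no  _ = ≈-trans (⊗-congˡ (φ x) (∏-filter φ P? xs))
  (solve 3 (λ a b c → a :* (b :* c) := b :* (a :* c)) ≈-refl (φ x) (∏ φ (filter P? xs)) (∏ φ (filter (¬? ∘ P?) xs)))

∏-unique-≈ : ∀ φ {xs ys} → Unique xs → Unique ys → (∀ {x} → x ∈ xs ⇔ x ∈ ys) → ∏ φ xs ≈ ∏ φ ys
∏-unique-≈ φ !xs !ys xs⇔ys = ∏-↭ φ (∼bag⇒↭ (unique∧set⇒bag !xs !ys xs⇔ys))

∏-unique-∣ : ∀ φ {xs ys} → Unique xs → Unique ys → (∀ {x} → x ∈ xs → x ∈ ys) → ∏ φ xs ∣ₚ ∏ φ ys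
∏-unique-∣ φ {xs} {ys} !xs !ys xs⊆ys = ∏ φ (filter (¬? ∘ (_∈? xs)) ys) , ≈-sym (begin
  ∏ φ ys                                                              ≈⟨ ∏-filter φ (_∈? xs) ys ⟩
  ∏ φ (filter (_∈? xs) ys) ⊗ ∏ φ (filter (¬? ∘ (_∈? xs)) ys)          ≈⟨ ⊗-congʳ _ (∏-unique-≈ φ (Unique.filter⁺ (_∈? xs) !ys) !xs ys∩xs⇔xs) ⟩
  ∏ φ xs ⊗ ∏ φ (filter (¬? ∘ (_∈? xs)) ys)                            ∎)
  where
  open ≈-Reasoning
  ys∩xs⇔xs : ∀ {x} → x ∈ filter (_∈? xs) ys ⇔ x ∈ xs
  ys∩xs⇔xs = mk⇔ (proj₂ ∘ ∈-filter⁻ (_∈? xs) {xs = ys}) (λ x∈xs → ∈-filter⁺ (_∈? xs) (xs⊆ys x∈xs) x∈xs)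

∈-properDivisors⁻ : ∀ {d m} → d ∈ properDivisors m → d < m × d ∣ m
∈-properDivisors⁻ {d} {m} d∈ with ∈-filter⁻ (_∣? m) {xs = upTo m} d∈
... | d∈upTo , d∣m = ∈-upTo⁻ d∈upTo , d∣m

∈-properDivisors⁺ : ∀ {d m} → d < m → d ∣ m → d ∈ properDivisors m
∈-properDivisors⁺ {d} {m} d<m d∣m = ∈-filter⁺ (_∣? m) (∈-upTo⁺ d<m) d∣m

properDivisors-unique : ∀ m → Unique (properDivisors m)
properDivisors-unique m = Unique.filter⁺ (_∣? m) (Unique.upTo⁺ m)

∈-properDivisors-pos : ∀ {d m} → 1 ≤ m → d ∈ properDivisors m → 1 ≤ d
∈-properDivisors-pos {zero}  {suc m} _ d∈ with () ← 0∣⇒≡0 (proj₂ (∈-properDivisors⁻ {0} {suc m} d∈))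
∈-properDivisors-pos {suc d}         _ _  = s≤s z≤n

divisors : ℕ → List ℕ
divisors m = m ∷ properDivisors m

divisors-unique : ∀ m → Unique (divisors m)
divisors-unique m = All.tabulate (λ d∈ m≡d → ℕ.<-irrefl (sym m≡d) (proj₁ (∈-properDivisors⁻ d∈))) ∷ properDivisors-unique m

∈-divisors⁻ : ∀ {d m} → d ∈ divisors m → d ∣ m
∈-divisors⁻ (here refl) = ∣-refl
∈-divisors⁻ (there d∈)    = proj₂ (∈-properDivisors⁻ d∈)

∈-divisors⁺ : ∀ {d m} → 1 ≤ m → d ∣ m → d ∈ divisors m
∈-divisors⁺ {d} {suc m} _ d∣m with ℕ.m≤n⇒m<n∨m≡n (∣⇒≤ d∣m)
... | inj₁ d<m    = there (∈-properDivisors⁺ d<m d∣m)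
... | inj₂ refl = here refl

map-cong-∈ : ∀ {φ ψ : ℕ → Poly} xs → (∀ {x} → x ∈ xs → φ x ≡ ψ x) → map φ xs ≡ map ψ xs
map-cong-∈ []       _   = refl
map-cong-∈ (x ∷ xs) φ≡ψ = cong₂ _∷_ (φ≡ψ (here refl)) (map-cong-∈ xs (φ≡ψ ∘ there))

cycloAux-fuel : ∀ f g d → 1 ≤ d → d ≤ f → d ≤ g → cycloAux f d ≡ cycloAux g d
cycloAux-fuel zero    g       (suc d) _   ()  _
cycloAux-fuel (suc f) zero    (suc d) _   _   ()
cycloAux-fuel (suc f) (suc g) d       1≤d d≤f d≤g =
  cong (λ L → divMonic (XmMinus1 d) (foldr mulP 1P L)) (map-cong-∈ (properDivisors d) λ e∈ →
    cycloAux-fuel f g _ (∈-properDivisors-pos 1≤d e∈)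
      (ℕ.≤-pred (ℕ.≤-trans (proj₁ (∈-properDivisors⁻ e∈)) d≤f))
      (ℕ.≤-pred (ℕ.≤-trans (proj₁ (∈-properDivisors⁻ e∈)) d≤g)))

Φ-unfold : ∀ m → 1 ≤ m → Φ m ≡ divMonic (X^ m ⊝ 1P) (∏ Φ (properDivisors m))
Φ-unfold (suc f) 1≤m = ≡.trans
  (cong (λ L → divMonic (XmMinus1 (suc f)) (foldr mulP 1P L)) (map-cong-∈ (properDivisors (suc f)) λ e∈ →
    cycloAux-fuel f _ _ (∈-properDivisors-pos 1≤m e∈) (ℕ.≤-pred (proj₁ (∈-properDivisors⁻ e∈))) ℕ.≤-refl))
  (cong (divMonic (XmMinus1 (suc f))) (foldr-⊗-map Φ (properDivisors (suc f))))

Monic-∏ : ∀ φ xs → (∀ {x} → x ∈ xs → ∃[ n ] Monic (φ x) n) → ∃[ n ] Monic (∏ φ xs) n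
Monic-∏ φ []       _     = 0 , Monic-1P
Monic-∏ φ (x ∷ xs) monic with monic (here refl) | Monic-∏ φ xs (monic ∘ there)
... | a , ma | b , mb = a + b , Monic-⊗ ma mb

record IsCyclotomic (m : ℕ) : Set where
  field
    degree  : ℕ
    monic   : Monic (Φ m) degree
    ∏-Φ≈    : ∏ Φ (divisors m) ≈ X^ m ⊝ 1P

open IsCyclotomic

∣⇒pos : ∀ {d m} → d ∣ suc m → 1 ≤ d
∣⇒pos {zero}  d∣m with () ← 0∣⇒≡0 d∣m
∣⇒pos {suc d} _   = s≤s z≤n

module CyclotomicStep (m : ℕ) (1≤m : 1 ≤ m) (ih : ∀ d → 1 ≤ d → d < m → IsCyclotomic d) where

  Φ∣X^-1 : ∀ d → 1 ≤ d → d < m → Φ d ∣ₚ X^ d ⊝ 1P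
  Φ∣X^-1 d 1≤d d<m = ∏ Φ (properDivisors d) , ∏-Φ≈ (ih d 1≤d d<m)

  -- With g = gcd d e < d: X^g − 1 lies in the ideal (Φ_d, Φ_e), while Φ_d (X^g − 1) divides X^d − 1.
  Φ-coprime-∤ : ∀ d e → 1 ≤ d → 1 ≤ e → d < m → e < m → ¬ d ∣ e → const (+ d) ∈⟨ Φ d , Φ e ⟩
  Φ-coprime-∤ d@(suc _) e 1≤d 1≤e d<m e<m d∤e with X^gcd-1-∈⟨⟩ d e
  ... | g , G , X^g-1∈ = ∈⟨⟩-trans d∈⟨Φd,X^g-1⟩ (∈⟨⟩-∣ (Φ∣X^-1 d 1≤d d<m) (Φ∣X^-1 e 1≤e e<m) X^g-1∈)
    where
    g∣d : g ∣ d
    g∣d = GCD.gcd∣m G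
    1≤g : 1 ≤ g
    1≤g = ∣⇒pos g∣d
    g<d : g < d
    g<d with ℕ.m≤n⇒m<n∨m≡n (∣⇒≤ g∣d)
    ... | inj₁ g<d  = g<d
    ... | inj₂ refl = contradiction (GCD.gcd∣n G) d∤e
    divisor-of-g : ∀ {y} → y ∈ divisors g → y ∈ properDivisors d
    divisor-of-g y∈ = ∈-properDivisors⁺ (ℕ.≤-<-trans (∣⇒≤ {{>-nonZero 1≤g}} (∈-divisors⁻ y∈)) g<d)
                                        (∣-trans (∈-divisors⁻ y∈) g∣d)
    X^g-1∣∏ : X^ g ⊝ 1P ∣ₚ ∏ Φ (properDivisors d)
    X^g-1∣∏ = ∣ₚ-respˡ (∏-Φ≈ (ih g 1≤g (ℕ.<-trans g<d d<m)))
                       (∏-unique-∣ Φ (divisors-unique g) (properDivisors-unique d) divisor-of-g)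
    d∈⟨Φd,X^g-1⟩ : const (+ d) ∈⟨ Φ d , X^ g ⊝ 1P ⟩
    d∈⟨Φd,X^g-1⟩ = X^-1-factors-coprime d (Φ d) (X^ g ⊝ 1P) (proj₁ X^g-1∣∏)
      (≈-trans (⊗-congˡ (Φ d) (proj₂ X^g-1∣∏)) (∏-Φ≈ (ih d 1≤d d<m)))

  Φ-coprime : ∀ d e → 1 ≤ d → 1 ≤ e → d < m → e < m → d ≢ e → ∃[ c ] c ≢ + 0 × const c ∈⟨ Φ d , Φ e ⟩
  Φ-coprime d e 1≤d 1≤e d<m e<m d≢e with d ∣? e | e ∣? d
  ... | no d∤e  | _       = + d , pos≢0 1≤d , Φ-coprime-∤ d e 1≤d 1≤e d<m e<m d∤e
  ... | yes d∣e | no e∤d  = + e , pos≢0 1≤e , ∈⟨⟩-swap (Φ-coprime-∤ e d 1≤e 1≤d e<m d<m e∤d)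
  ... | yes d∣e | yes e∣d = contradiction (∣-antisym d∣e e∣d) d≢e

  InRange : ℕ → Set
  InRange d = 1 ≤ d × d < m

  Φ-coprime-∏ : ∀ d → InRange d → ∀ xs → All InRange xs → d ∉ xs → ∃[ c ] c ≢ + 0 × const c ∈⟨ Φ d , ∏ Φ xs ⟩
  Φ-coprime-∏ d _ []       _ _ = + 1 , (λ ()) , const-1-∈⟨⟩ (Φ d)
  Φ-coprime-∏ d d∈ (x ∷ xs) ((1≤x , x<m) ∷ xs∈) d∉x∷xs
    with Φ-coprime d x (proj₁ d∈) 1≤x (proj₂ d∈) x<m (d∉x∷xs ∘ here)
       | Φ-coprime-∏ d d∈ xs xs∈ (d∉x∷xs ∘ there)
  ... | c , c≢0 , cx | c′ , c′≢0 , cxs = c ℤ.* c′ , *-≢0 c≢0 c′≢0 , const-∈⟨⟩-⊗ cx cxs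

  properDivisor-in-range : ∀ {d} → d ∈ properDivisors m → InRange d
  properDivisor-in-range d∈ = ∈-properDivisors-pos 1≤m d∈ , proj₁ (∈-properDivisors⁻ {m = m} d∈)

  ih∈ : ∀ {d} → d ∈ properDivisors m → IsCyclotomic d
  ih∈ d∈ = ih _ (proj₁ (properDivisor-in-range d∈)) (proj₂ (properDivisor-in-range d∈))

  Φ∣X^m-1 : ∀ {d} → d ∈ properDivisors m → Φ d ∣ₚ X^ m ⊝ 1P
  Φ∣X^m-1 {d} d∈ with proj₂ (∈-properDivisors⁻ {m = m} d∈)
  ... | divides k m≡kd = ∣ₚ-respʳ {Φ d} (⊕-cong (X^-cong (sym m≡kd)) (≈-refl {negP 1P}))
                                  (∣ₚ-trans {Φ d} (∏ Φ (properDivisors d) , ∏-Φ≈ (ih∈ d∈)) (X^-1∣X^*-1 k d))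

  -- Φ_x divides X^m − 1 = ∏ xs · r and is coprime to ∏ xs, hence divides r.
  ∏-∣-X^m-1 : ∀ xs → Unique xs → (∀ {x} → x ∈ xs → x ∈ properDivisors m) → ∏ Φ xs ∣ₚ X^ m ⊝ 1P
  ∏-∣-X^m-1 []       _             _   = X^ m ⊝ 1P , ⊗-identityˡ (X^ m ⊝ 1P)
  ∏-∣-X^m-1 (x ∷ xs) (x∉xs ∷ !xs) xs⊆ = extend (∏-∣-X^m-1 xs !xs (xs⊆ ∘ there)) coprime
    where
    x∈ : x ∈ properDivisors m
    x∈ = xs⊆ (here refl)
    coprime : ∃[ c ] c ≢ + 0 × const c ∈⟨ Φ x , ∏ Φ xs ⟩
    coprime = Φ-coprime-∏ x (properDivisor-in-range x∈) xs
                          (All.tabulate (properDivisor-in-range ∘ xs⊆ ∘ there)) (All¬⇒¬Any x∉xs)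
    extend : ∏ Φ xs ∣ₚ X^ m ⊝ 1P → ∃[ c ] c ≢ + 0 × const c ∈⟨ Φ x , ∏ Φ xs ⟩ → ∏ Φ (x ∷ xs) ∣ₚ X^ m ⊝ 1P
    extend (r , ∏xs⊗r≈) (c , c≢0 , c∈) = b , (begin
      (Φ x ⊗ ∏ Φ xs) ⊗ b    ≈⟨ solve 3 (λ a p b → (a :* p) :* b := p :* (a :* b)) ≈-refl (Φ x) (∏ Φ xs) b ⟩
      ∏ Φ xs ⊗ (Φ x ⊗ b)    ≈⟨ ⊗-congˡ (∏ Φ xs) Φx⊗b≈r ⟩
      ∏ Φ xs ⊗ r            ≈⟨ ∏xs⊗r≈ ⟩
      X^ m ⊝ 1P             ∎)
      where
      open ≈-Reasoning
      Φx∣r : Φ x ∣ₚ r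
      Φx∣r = Monic-∈⟨⟩-∣ (monic (ih∈ x∈)) c≢0 c∈ r (∣ₚ-respʳ {Φ x} (≈-sym ∏xs⊗r≈) (Φ∣X^m-1 x∈))
      b : Poly
      b = proj₁ Φx∣r
      Φx⊗b≈r : Φ x ⊗ b ≈ r
      Φx⊗b≈r = proj₂ Φx∣r

  ∏⊗Φ≈X^m-1 : ∀ {n S} → Monic (∏ Φ (properDivisors m)) n → ∏ Φ (properDivisors m) ⊗ S ≈ X^ m ⊝ 1P →
              ∏ Φ (properDivisors m) ⊗ Φ m ≈ X^ m ⊝ 1P
  ∏⊗Φ≈X^m-1 ∏-monic ∏⊗S≈ = ≈-trans
    (⊗-congˡ (∏ Φ (properDivisors m)) (≈-trans (≈-reflexive (Φ-unfold m 1≤m)) (divMonic-≈ ∏-monic (Monic-X^-1 m 1≤m) ∏⊗S≈)))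
    ∏⊗S≈

  isCyclotomic-step : IsCyclotomic m
  isCyclotomic-step = build (Monic-∏ Φ (properDivisors m) (λ d∈ → degree (ih∈ d∈) , monic (ih∈ d∈)))
                            (∏-∣-X^m-1 (properDivisors m) (properDivisors-unique m) id)
    where
    build : ∃[ n ] Monic (∏ Φ (properDivisors m)) n → ∏ Φ (properDivisors m) ∣ₚ X^ m ⊝ 1P → IsCyclotomic m
    build (n , ∏-monic) (_ , ∏⊗S≈) = record
      { degree = proj₁ Φm-monic ; monic = proj₂ (proj₂ Φm-monic) ; ∏-Φ≈ = ≈-trans (⊗-comm (Φ m) _) ∏⊗Φm≈ }
      where
      ∏⊗Φm≈ : ∏ Φ (properDivisors m) ⊗ Φ m ≈ X^ m ⊝ 1P
      ∏⊗Φm≈ = ∏⊗Φ≈X^m-1 ∏-monic ∏⊗S≈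
      Φm-monic : ∃[ t ] n + t ≡ m × Monic (Φ m) t
      Φm-monic = Monic-quotient ∏-monic (Monic-X^-1 m 1≤m) ∏⊗Φm≈

isCyclotomic : ∀ m → 1 ≤ m → IsCyclotomic m
isCyclotomic = <-rec _ λ m rec 1≤m → CyclotomicStep.isCyclotomic-step m 1≤m (λ d 1≤d d<m → rec d<m 1≤d)

-- Substituting X^p

infixl 9 _∘X^_

-- f(X^p), by Horner's scheme; for p = 0 this gives f itself rather than the constant f(1).
_∘X^_ : Poly → ℕ → Poly
[]      ∘X^ p = []
(a ∷ f) ∘X^ p = a ∷ shift (p ∸ 1) (f ∘X^ p)

∷-shift : ∀ q a r → a ∷ shift q r ≈ const a ⊕ X^ (suc q) ⊗ r
∷-shift q a r = ≈-trans (∷≈const⊕X⊗ a (shift q r))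
  (⊕-cong (≈-refl {const a}) (≈-trans (⊗-congˡ (X^ 1) (shift≈X^⊗ q r))
                                      (≈-trans (≈-sym (⊗-assoc (X^ 1) (X^ q) r)) (⊗-congʳ r (X^-+ 1 q)))))

∘X^-≈0 : ∀ p {f} → f ≈ 0P → f ∘X^ p ≈ 0P
∘X^-≈0 p {[]}    _ = ≈-refl
∘X^-≈0 p {a ∷ f} e rewrite ∷≈0-head e = 0∷-≈0 (≈-trans (shift-cong (p ∸ 1) (∘X^-≈0 p (∷≈0-tail e))) (shift-0P (p ∸ 1)))

∘X^-cong : ∀ p {f g} → f ≈ g → f ∘X^ p ≈ g ∘X^ p
∘X^-cong p {[]}    {g}     e = ≈-sym (∘X^-≈0 p (≈-sym e))
∘X^-cong p {a ∷ f} {[]}    e = ∘X^-≈0 p e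
∘X^-cong p {a ∷ f} {b ∷ g} e = ∷-cong (coeff-≡ e 0) (shift-cong (p ∸ 1) (∘X^-cong p (∷-injective e)))

∘X^-⊕ : ∀ p f g → (f ⊕ g) ∘X^ p ≈ f ∘X^ p ⊕ g ∘X^ p
∘X^-⊕ p []      g       = ≈-refl
∘X^-⊕ p (a ∷ f) []      = ≈-sym (⊕-identityʳ _)
∘X^-⊕ p (a ∷ f) (b ∷ g) = ∷-cong refl (≈-trans (shift-cong (p ∸ 1) (∘X^-⊕ p f g)) (shift-⊕ (p ∸ 1) _ _))

∘X^-· : ∀ p a f → (a · f) ∘X^ p ≈ a · f ∘X^ p
∘X^-· p a []      = ≈-refl
∘X^-· p a (b ∷ f) = ∷-cong refl (≈-trans (shift-cong (p ∸ 1) (∘X^-· p a f)) (shift-· (p ∸ 1) a _))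

negP≈-1· : ∀ f → negP f ≈ -[1+ 0 ] · f
negP≈-1· f = mk≈ λ j → trans (coeff-negP f j) (trans (sym (ℤ.-1*i≡-i (coeff f j))) (sym (coeff-· -[1+ 0 ] f j)))

∘X^-negP : ∀ p f → negP f ∘X^ p ≈ negP (f ∘X^ p)
∘X^-negP p f = ≈-trans (∘X^-cong p (negP≈-1· f)) (≈-trans (∘X^-· p -[1+ 0 ] f) (≈-sym (negP≈-1· (f ∘X^ p))))

∘X^-⊗ : ∀ p f g → (f ⊗ g) ∘X^ p ≈ f ∘X^ p ⊗ g ∘X^ p
∘X^-⊗ p []      g = ≈-refl
∘X^-⊗ p (a ∷ f) g = begin
  (a · g ⊕ (+ 0 ∷ f ⊗ g)) ∘X^ p                      ≈⟨ ∘X^-⊕ p (a · g) (+ 0 ∷ f ⊗ g) ⟩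
  (a · g) ∘X^ p ⊕ (+ 0 ∷ shift q ((f ⊗ g) ∘X^ p))    ≈⟨ ⊕-cong (≈-trans (∘X^-· p a g) (≈-sym (const-⊗ a (g ∘X^ p))))
                                                                (≈-trans (∷-shift q (+ 0) _) (⊕-cong const-0 (⊗-congˡ (X^ (suc q)) (∘X^-⊗ p f g)))) ⟩
  const a ⊗ g ∘X^ p ⊕ (0P ⊕ X^ (suc q) ⊗ (f ∘X^ p ⊗ g ∘X^ p))
    ≈⟨ solve 4 (λ A G X F → A :* G :+ (Κ 0P :+ X :* (F :* G)) := (A :+ X :* F) :* G) ≈-refl (const a) (g ∘X^ p) (X^ (suc q)) (f ∘X^ p) ⟩
  (const a ⊕ X^ (suc q) ⊗ f ∘X^ p) ⊗ g ∘X^ p         ≈⟨ ⊗-congʳ (g ∘X^ p) (≈-sym (∷-shift q a (f ∘X^ p))) ⟩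
  (a ∷ f) ∘X^ p ⊗ g ∘X^ p                            ∎
  where
  open ≈-Reasoning
  q : ℕ
  q = p ∸ 1

∘X^-X^ : ∀ p .{{_ : NonZero p}} n → X^ n ∘X^ p ≈ X^ (n * p)
∘X^-X^ (suc q) zero    = ∷-cong refl (shift-0P q)
∘X^-X^ (suc q) (suc n) = ∷-cong refl (begin
  shift q (X^ n ∘X^ suc q)     ≈⟨ shift-cong q (∘X^-X^ (suc q) n) ⟩
  shift q (X^ (n * suc q))     ≈⟨ shift≈X^⊗ q (X^ (n * suc q)) ⟩
  X^ q ⊗ X^ (n * suc q)        ≈⟨ X^-+ q (n * suc q) ⟩
  X^ (q + n * suc q)           ∎)
  where open ≈-Reasoning

∘X^-X^-1 : ∀ p .{{_ : NonZero p}} n → (X^ n ⊝ 1P) ∘X^ p ≈ X^ (n * p) ⊝ 1P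
∘X^-X^-1 p n = ≈-trans (∘X^-⊕ p (X^ n) (negP 1P)) (⊕-cong (∘X^-X^ p n) (∷-cong refl (shift-0P (p ∸ 1))))

∘X^-∏ : ∀ p φ xs → ∏ φ xs ∘X^ p ≈ ∏ (λ x → φ x ∘X^ p) xs
∘X^-∏ p φ []       = ∷-cong refl (shift-0P (p ∸ 1))
∘X^-∏ p φ (x ∷ xs) = ≈-trans (∘X^-⊗ p (φ x) (∏ φ xs)) (⊗-congˡ (φ x ∘X^ p) (∘X^-∏ p φ xs))

coeff-∘X^-* : ∀ p .{{_ : NonZero p}} f j → coeff (f ∘X^ p) (j * p) ≡ coeff f j
coeff-∘X^-* (suc q) []      j       = refl
coeff-∘X^-* (suc q) (a ∷ f) zero    = refl
coeff-∘X^-* (suc q) (a ∷ f) (suc j) = trans (coeff-shift q (f ∘X^ suc q) (j * suc q)) (coeff-∘X^-* (suc q) f j)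

coeff-∘X^-≢0-mod : ∀ p f j r → 0 < r → r < p → coeff (f ∘X^ p) (j * p + r) ≡ + 0
coeff-∘X^-≢0-mod (suc q) []      j       r       _   _         = refl
coeff-∘X^-≢0-mod (suc q) (a ∷ f) zero    (suc r) _   (s≤s r<q) = coeff-shift-< q (f ∘X^ suc q) r<q
coeff-∘X^-≢0-mod (suc q) (a ∷ f) (suc j) r       0<r r<p       = begin
  coeff (shift q (f ∘X^ suc q)) (q + j * suc q + r)   ≡⟨ cong (coeff (shift q (f ∘X^ suc q))) (ℕ.+-assoc q (j * suc q) r) ⟩
  coeff (shift q (f ∘X^ suc q)) (q + (j * suc q + r)) ≡⟨ coeff-shift q (f ∘X^ suc q) (j * suc q + r) ⟩
  coeff (f ∘X^ suc q) (j * suc q + r)                 ≡⟨ coeff-∘X^-≢0-mod (suc q) f j r 0<r r<p ⟩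
  + 0                                                 ∎
  where open ≡.≡-Reasoning

Monic-∘X^ : ∀ p .{{_ : NonZero p}} {f n} → Monic f n → Monic (f ∘X^ p) (n * p)
Monic-∘X^ p {f} {n} (df , cf) = bounded , trans (coeff-∘X^-* p f n) cf
  where
  bounded : f ∘X^ p deg≤ n * p
  bounded i n*p<i with i % p in i%p≡r | m≡m%n+[m/n]*n i p
  ... | zero  | i≡ = trans (cong (coeff (f ∘X^ p)) i≡) (trans (coeff-∘X^-* p f (i / p)) (df (i / p) n<i/p))
    where
    n<i/p : n < i / p
    n<i/p = ℕ.*-cancelʳ-< p n (i / p) (≡.subst (n * p <_) i≡ n*p<i)
  ... | suc r | i≡ = trans (cong (coeff (f ∘X^ p)) (trans i≡ (ℕ.+-comm (suc r) _)))
                           (coeff-∘X^-≢0-mod p f (i / p) (suc r) (s≤s z≤n) (≡.subst (_< p) i%p≡r (m%n<n i p)))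

module PrimeSubstitution (p : ℕ) (p-prime : Prime p) where

  instance
    p≢0 : NonZero p
    p≢0 = prime⇒nonZero p-prime

  p∤? : ∀ d → Dec (¬ p ∣ d)
  p∤? d = ¬? (p ∣? d)

  -- Φ_l(X^p) is Φ_{lp} when p ∣ l and Φ_{lp} Φ_l otherwise.
  ψ : ℕ → Poly
  ψ l with p ∣? l
  ... | yes _ = Φ (l * p)
  ... | no  _ = Φ (l * p) ⊗ Φ l

  ∏ψ≈ : ∀ xs → ∏ ψ xs ≈ ∏ Φ (map (_* p) xs) ⊗ ∏ Φ (filter p∤? xs)
  ∏ψ≈ []       = ≈-sym (⊗-identityˡ 1P)
  ∏ψ≈ (x ∷ xs) with p ∣? x
  ... | yes _ =
    ≈-trans (⊗-congˡ (Φ (x * p)) (∏ψ≈ xs)) (≈-sym (⊗-assoc (Φ (x * p)) _ _))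
  ... | no  _ =
    ≈-trans (⊗-congˡ (Φ (x * p) ⊗ Φ x) (∏ψ≈ xs))
            (solve 4 (λ a b c d → (a :* b) :* (c :* d) := (a :* c) :* (b :* d)) ≈-refl
                   (Φ (x * p)) (Φ x) (∏ Φ (map (_* p) xs)) (∏ Φ (filter p∤? xs)))

  p∤⇒coprime : ∀ {v} → ¬ p ∣ v → Coprime v p
  p∤⇒coprime p∤v (i∣v , i∣p) with prime⇒irreducible p-prime i∣p
  ... | inj₁ i≡1    = i≡1
  ... | inj₂ refl   = contradiction i∣v p∤v

  split-divisors : ℕ → List ℕ
  split-divisors l = map (_* p) (divisors l) ++ filter p∤? (divisors l)

  split-divisors-unique : ∀ l → Unique (split-divisors l)
  split-divisors-unique l = Unique.++⁺ (Unique.map⁺ (ℕ.*-cancelʳ-≡ _ _ p) (divisors-unique l))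
                                       (Unique.filter⁺ p∤? (divisors-unique l)) disjoint
    where
    disjoint : ∀ {v} → ¬ (v ∈ map (_* p) (divisors l) × v ∈ filter p∤? (divisors l))
    disjoint (v∈ , v∈′) with ∈-map⁻ (_* p) {xs = divisors l} v∈ | ∈-filter⁻ p∤? {xs = divisors l} v∈′
    ... | e , _ , refl | _ , p∤ep = p∤ep (n∣m*n e)

  ∈-split-divisors : ∀ l → 1 ≤ l → ∀ {v} → v ∈ split-divisors l ⇔ v ∈ divisors (l * p)
  ∈-split-divisors l 1≤l = mk⇔ to from
    where
    1≤lp : 1 ≤ l * p
    1≤lp = ℕ.*-mono-≤ 1≤l (>-nonZero⁻¹ p)
    to : ∀ {v} → v ∈ split-divisors l → v ∈ divisors (l * p)
    to v∈ with ∈-++⁻ (map (_* p) (divisors l)) v∈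
    ... | inj₂ v∈′ = ∈-divisors⁺ 1≤lp (∣-trans (∈-divisors⁻ (proj₁ (∈-filter⁻ p∤? {xs = divisors l} v∈′))) (m∣m*n p))
    ... | inj₁ v∈′ with ∈-map⁻ (_* p) {xs = divisors l} v∈′
    ...   | e , e∈ , refl = ∈-divisors⁺ 1≤lp (*-monoˡ-∣ p (∈-divisors⁻ e∈))
    from : ∀ {v} → v ∈ divisors (l * p) → v ∈ split-divisors l
    from {v} v∈ with p ∣? v
    ... | yes (divides k refl) = ∈-++⁺ˡ (∈-map⁺ (_* p) {x = k} (∈-divisors⁺ 1≤l (*-cancelʳ-∣ p (∈-divisors⁻ v∈))))
    ... | no p∤v = ∈-++⁺ʳ (map (_* p) (divisors l))
      (∈-filter⁺ p∤? (∈-divisors⁺ 1≤l (coprime-divisor (p∤⇒coprime p∤v) (≡.subst (v ∣_) (ℕ.*-comm l p) (∈-divisors⁻ v∈)))) p∤v)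

  ∏ψ-divisors : ∀ l → 1 ≤ l → ∏ ψ (divisors l) ≈ ∏ Φ (divisors (l * p))
  ∏ψ-divisors l 1≤l = begin
    ∏ ψ (divisors l)                                                  ≈⟨ ∏ψ≈ (divisors l) ⟩
    ∏ Φ (map (_* p) (divisors l)) ⊗ ∏ Φ (filter p∤? (divisors l))     ≈⟨ ∏-++ Φ (map (_* p) (divisors l)) _ ⟨
    ∏ Φ (split-divisors l)                                            ≈⟨ ∏-unique-≈ Φ (split-divisors-unique l) (divisors-unique (l * p)) (∈-split-divisors l 1≤l) ⟩
    ∏ Φ (divisors (l * p))                                            ∎
    where open ≈-Reasoning

  1≤*p : ∀ {l} → 1 ≤ l → 1 ≤ l * p
  1≤*p 1≤l = ℕ.*-mono-≤ 1≤l (>-nonZero⁻¹ p)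

  Monic-ψ : ∀ l → 1 ≤ l → ∃[ n ] Monic (ψ l) n
  Monic-ψ l 1≤l with p ∣? l
  ... | yes _ = _ , monic (isCyclotomic (l * p) (1≤*p 1≤l))
  ... | no  _ = _ , Monic-⊗ (monic (isCyclotomic (l * p) (1≤*p 1≤l))) (monic (isCyclotomic l 1≤l))

  -- Substituting X^p into X^l − 1 = ∏_{d ∣ l} Φ_d gives X^{lp} − 1 = ∏_{d ∣ lp} Φ_d; cancel the
  -- factors for d < l.
  Φ∘X^≈ψ : ∀ l → 1 ≤ l → Φ l ∘X^ p ≈ ψ l
  Φ∘X^≈ψ = <-rec (λ l → 1 ≤ l → Φ l ∘X^ p ≈ ψ l) step
    where
    step : ∀ l → (∀ {e} → e < l → 1 ≤ e → Φ e ∘X^ p ≈ ψ e) → 1 ≤ l → Φ l ∘X^ p ≈ ψ l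
    step l rec 1≤l = Monic-⊗-cancelˡ {Q} (proj₂ mQ) {Φ l ∘X^ p} {ψ l} (begin
      Q ⊗ Φ l ∘X^ p                                       ≈⟨ ⊗-comm Q (Φ l ∘X^ p) ⟩
      Φ l ∘X^ p ⊗ Q                                       ≈⟨ ⊗-congˡ (Φ l ∘X^ p) (∏-cong (properDivisors l) ih) ⟨
      Φ l ∘X^ p ⊗ ∏ (λ e → Φ e ∘X^ p) (properDivisors l)  ≈⟨ ∘X^-∏ p Φ (divisors l) ⟨
      ∏ Φ (divisors l) ∘X^ p                              ≈⟨ ∘X^-cong p (∏-Φ≈ (isCyclotomic l 1≤l)) ⟩
      (X^ l ⊝ 1P) ∘X^ p                                   ≈⟨ ∘X^-X^-1 p l ⟩
      X^ (l * p) ⊝ 1P                                     ≈⟨ ∏-Φ≈ (isCyclotomic (l * p) (1≤*p 1≤l)) ⟨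
      ∏ Φ (divisors (l * p))                              ≈⟨ ∏ψ-divisors l 1≤l ⟨
      ψ l ⊗ Q                                             ≈⟨ ⊗-comm (ψ l) Q ⟩
      Q ⊗ ψ l                                             ∎)
      where
      open ≈-Reasoning
      Q : Poly
      Q = ∏ ψ (properDivisors l)
      ih : ∀ {e} → e ∈ properDivisors l → Φ e ∘X^ p ≈ ψ e
      ih e∈ = rec (proj₁ (∈-properDivisors⁻ e∈)) (∈-properDivisors-pos 1≤l e∈)
      mQ : ∃[ n ] Monic Q n
      mQ = Monic-∏ ψ (properDivisors l) (Monic-ψ _ ∘ ∈-properDivisors-pos 1≤l)

  ψ-∣ : ∀ {l} → p ∣ l → ψ l ≡ Φ (l * p)
  ψ-∣ {l} p∣l with p ∣? l
  ... | yes _   = refl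
  ... | no  p∤l = contradiction p∣l p∤l

  ψ-∤ : ∀ {l} → ¬ p ∣ l → ψ l ≡ Φ (l * p) ⊗ Φ l
  ψ-∤ {l} p∤l with p ∣? l
  ... | yes p∣l = contradiction p∣l p∤l
  ... | no  _   = refl

  Φ-*-p-∣ : ∀ l → 1 ≤ l → p ∣ l → Φ (l * p) ≈ Φ l ∘X^ p
  Φ-*-p-∣ l 1≤l p∣l = ≈-sym (≈-trans (Φ∘X^≈ψ l 1≤l) (≈-reflexive (ψ-∣ p∣l)))

  Φ-*-p-∤ : ∀ l → 1 ≤ l → ¬ p ∣ l → Φ (l * p) ⊗ Φ l ≈ Φ l ∘X^ p
  Φ-*-p-∤ l 1≤l p∤l = ≈-sym (≈-trans (Φ∘X^≈ψ l 1≤l) (≈-reflexive (ψ-∤ p∤l)))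

-- Degrees of cyclotomic polynomials

Φ-monic : ∀ m → 1 ≤ m → Monic (Φ m) (deg (Φ m))
Φ-monic m 1≤m = subst (Monic (Φ m)) (sym (Monic⇒deg≡ (monic (isCyclotomic m 1≤m)))) (monic (isCyclotomic m 1≤m))

prime≥2 : ∀ {p} → Prime p → 2 ≤ p
prime≥2 {zero}          p-prime = contradiction p-prime ¬prime[0]
prime≥2 {suc zero}      p-prime = contradiction p-prime ¬prime[1]
prime≥2 {suc (suc p)}   _       = s≤s (s≤s z≤n)

prime-factor : ∀ {m} → 1 < m → ∃[ p ] Prime p × p ∣ m
prime-factor {m} 1<m with factorise m {{>-nonZero (ℕ.<-trans (s≤s z≤n) 1<m)}}
... | record { factors = [] ; isFactorisation = m≡1 } = contradiction m≡1 (ℕ.>⇒≢ 1<m)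
... | record { factors = p ∷ ps ; isFactorisation = m≡ ; factorsPrime = p-prime ∷ _ } =
  p , p-prime , divides (product ps) (trans m≡ (ℕ.*-comm p (product ps)))

cofactor-bounds : ∀ l {p} → Prime p → 1 ≤ l * p → 1 ≤ l × l < l * p
cofactor-bounds zero    _       ()
cofactor-bounds (suc l) {p} p-prime _ = s≤s z≤n , ℕ.m<m*n (suc l) p (prime≥2 p-prime)

module _ {p} (p-prime : Prime p) {l} (1≤l : 1 ≤ l) where
  open PrimeSubstitution p p-prime

  deg-Φ-*-∣ : p ∣ l → deg (Φ (l * p)) ≡ deg (Φ l) * p
  deg-Φ-*-∣ p∣l = trans (deg-cong (Φ-*-p-∣ l 1≤l p∣l)) (Monic⇒deg≡ (Monic-∘X^ p (Φ-monic l 1≤l)))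

  deg-Φ-*-∤ : ¬ p ∣ l → deg (Φ (l * p)) ≡ deg (Φ l) * (p ∸ 1)
  deg-Φ-*-∤ p∤l = begin
    deg (Φ (l * p))                              ≡⟨ ℕ.m+n∸n≡m (deg (Φ (l * p))) (deg (Φ l)) ⟨
    deg (Φ (l * p)) + deg (Φ l) ∸ deg (Φ l)      ≡⟨ cong (_∸ deg (Φ l)) deg-product ⟩
    deg (Φ l) * p ∸ deg (Φ l)                    ≡⟨ cong (deg (Φ l) * p ∸_) (ℕ.*-identityʳ (deg (Φ l))) ⟨
    deg (Φ l) * p ∸ deg (Φ l) * 1                ≡⟨ ℕ.*-distribˡ-∸ (deg (Φ l)) p 1 ⟨
    deg (Φ l) * (p ∸ 1)                          ∎
    where
    open ≡.≡-Reasoning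
    deg-product : deg (Φ (l * p)) + deg (Φ l) ≡ deg (Φ l) * p
    deg-product = trans (sym (Monic⇒deg≡ (Monic-⊗ (Φ-monic (l * p) (1≤*p 1≤l)) (Φ-monic l 1≤l))))
                        (trans (deg-cong (Φ-*-p-∤ l 1≤l p∤l)) (Monic⇒deg≡ (Monic-∘X^ p (Φ-monic l 1≤l))))

  deg-Φ-*-≥ : deg (Φ l) * (p ∸ 1) ≤ deg (Φ (l * p))
  deg-Φ-*-≥ with p ∣? l
  ... | yes p∣l = ℕ.≤-trans (ℕ.*-monoʳ-≤ (deg (Φ l)) (ℕ.m∸n≤m p 1)) (ℕ.≤-reflexive (sym (deg-Φ-*-∣ p∣l)))
  ... | no  p∤l = ℕ.≤-reflexive (sym (deg-Φ-*-∤ p∤l))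

deg-Φ≥1 : ∀ m → 1 ≤ m → 1 ≤ deg (Φ m)
deg-Φ≥1 = <-rec _ step
  where
  step : ∀ m → (∀ {l} → l < m → 1 ≤ l → 1 ≤ deg (Φ l)) → 1 ≤ m → 1 ≤ deg (Φ m)
  step m rec 1≤m with ℕ.m≤n⇒m<n∨m≡n 1≤m
  ... | inj₂ refl = s≤s z≤n
  ... | inj₁ 1<m  with prime-factor 1<m
  ...   | p , p-prime , divides l refl with cofactor-bounds l p-prime 1≤m
  ...     | 1≤l , l<m = ℕ.≤-trans (ℕ.*-mono-≤ (rec l<m 1≤l) (ℕ.∸-monoˡ-≤ 1 (prime≥2 p-prime))) (deg-Φ-*-≥ p-prime 1≤l)

odd-cofactor≥3 : ∀ {l} → 3 ≤ l * 2 → ¬ 2 ∣ l → 3 ≤ l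
odd-cofactor≥3 {suc (suc (suc _))} _ _   = s≤s (s≤s (s≤s z≤n))
odd-cofactor≥3 {suc (suc zero)}    _ 2∤2 = contradiction (divides 1 refl) 2∤2
odd-cofactor≥3 {suc zero}          (s≤s (s≤s ())) _

deg-Φ≥2 : ∀ m → 3 ≤ m → 2 ≤ deg (Φ m)
deg-Φ≥2 = <-rec _ step
  where
  step : ∀ m → (∀ {l} → l < m → 3 ≤ l → 2 ≤ deg (Φ l)) → 3 ≤ m → 2 ≤ deg (Φ m)
  step m rec 3≤m with prime-factor (ℕ.<⇒≤ 3≤m)
  ... | p , p-prime , divides l refl
    with cofactor-bounds l p-prime (ℕ.≤-trans (s≤s z≤n) 3≤m) | ℕ.m≤n⇒m<n∨m≡n (prime≥2 p-prime)
  ... | 1≤l , l<m | inj₁ 3≤p =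
    ℕ.≤-trans (ℕ.*-mono-≤ (deg-Φ≥1 l 1≤l) (ℕ.∸-monoˡ-≤ 1 3≤p)) (deg-Φ-*-≥ p-prime 1≤l)
  ... | 1≤l , l<m | inj₂ refl with 2 ∣? l
  ...   | yes 2∣l = ℕ.≤-trans (ℕ.*-monoˡ-≤ 2 (deg-Φ≥1 l 1≤l)) (ℕ.≤-reflexive (sym (deg-Φ-*-∣ p-prime 1≤l 2∣l)))
  ...   | no  2∤l = ℕ.≤-trans (ℕ.≤-trans (rec l<m (odd-cofactor≥3 3≤m 2∤l)) (ℕ.≤-reflexive (sym (ℕ.*-identityʳ _))))
                              (ℕ.≤-reflexive (sym (deg-Φ-*-∤ p-prime 1≤l 2∤l)))

deg-Φ≥4 : ∀ {m r} → 1 ≤ m → Prime r → 5 ≤ r → r ∣ m → 4 ≤ deg (Φ m)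
deg-Φ≥4 1≤m r-prime 5≤r (divides l refl) with cofactor-bounds l r-prime 1≤m
... | 1≤l , _ = ℕ.≤-trans (ℕ.*-mono-≤ (deg-Φ≥1 l 1≤l) (ℕ.∸-monoˡ-≤ 1 5≤r)) (deg-Φ-*-≥ r-prime 1≤l)

⊗-subleading : ∀ {f g a b} → Monic f (suc a) → Monic g (suc b) →
               coeff (f ⊗ g) (suc (a + b)) ≡ coeff f a ℤ.+ coeff g b
⊗-subleading {f} {g} {a} {b} (df , cf) (dg , cg) = begin
  coeff (f ⊗ g) (suc (a + b))                                           ≡⟨ coeff-≡ split (suc (a + b)) ⟩
  coeff (f′ ⊗ g ⊕ X^ (suc a) ⊗ g) (suc (a + b))                         ≡⟨ coeff-⊕ (f′ ⊗ g) (X^ (suc a) ⊗ g) (suc (a + b)) ⟩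
  coeff (f′ ⊗ g) (suc (a + b)) ℤ.+ coeff (X^ (suc a) ⊗ g) (suc a + b)   ≡⟨ cong₂ ℤ._+_ f′⊗g-top X^⊗g-top ⟩
  coeff f a ℤ.+ coeff g b                                               ∎
  where
  open ≡.≡-Reasoning
  f′ : Poly
  f′ = f ⊝ X^ (suc a)
  coeff-f′ : ∀ j → j ≢ suc a → coeff f′ j ≡ coeff f j
  coeff-f′ j j≢ = trans (coeff-⊝ f (X^ (suc a)) j) (trans (cong (ℤ._-_ (coeff f j)) (coeff-X^-≢ (suc a) j≢)) (ℤ.+-identityʳ _))
  df′ : f′ deg≤ a
  df′ j a<j with ℕ.m≤n⇒m<n∨m≡n a<j
  ... | inj₁ suc-a<j = trans (coeff-f′ j (ℕ.>⇒≢ suc-a<j)) (df j suc-a<j)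
  ... | inj₂ refl    = trans (coeff-⊝ f (X^ (suc a)) (suc a)) (trans (cong₂ ℤ._-_ cf (coeff-X^-≡ (suc a))) refl)
  split : f ⊗ g ≈ f′ ⊗ g ⊕ X^ (suc a) ⊗ g
  split = ≈-trans (⊗-congʳ g (solve 2 (λ f x → f := (f :+ :- x) :+ x) ≈-refl f (X^ (suc a)))) (⊗-distribʳ-⊕ f′ (X^ (suc a)) g)
  f′⊗g-top : coeff (f′ ⊗ g) (suc (a + b)) ≡ coeff f a
  f′⊗g-top = begin
    coeff (f′ ⊗ g) (suc (a + b))         ≡⟨ cong (coeff (f′ ⊗ g)) (ℕ.+-suc a b) ⟨
    coeff (f′ ⊗ g) (a + suc b)           ≡⟨ proj₂ (⊗-leading f′ a g (suc b) df′ dg) ⟩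
    coeff f′ a ℤ.* coeff g (suc b)       ≡⟨ cong₂ ℤ._*_ (coeff-f′ a (ℕ.<⇒≢ (ℕ.n<1+n a))) cg ⟩
    coeff f a ℤ.* + 1                    ≡⟨ ℤ.*-identityʳ (coeff f a) ⟩
    coeff f a                            ∎
  X^⊗g-top : coeff (X^ (suc a) ⊗ g) (suc a + b) ≡ coeff g b
  X^⊗g-top = trans (coeff-≡ (≈-sym (shift≈X^⊗ (suc a) g)) (suc a + b)) (coeff-shift (suc a) g b)

SquareFree : ℕ → Set
SquareFree m = ∀ r → Prime r → ¬ r * r ∣ m

-- For m = l p with p ∤ l: Φ_m Φ_l = Φ_l(X^p) has no X^(deg − 1) term, so the subleading
-- coefficients of Φ_m and Φ_l are opposite.
Φ-subleading≢0 : ∀ m → 1 ≤ m → SquareFree m → ∀ {a} → deg (Φ m) ≡ suc a → coeff (Φ m) a ≢ + 0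
Φ-subleading≢0 = <-rec _ step
  where
  step : ∀ m → (∀ {l} → l < m → 1 ≤ l → SquareFree l → ∀ {b} → deg (Φ l) ≡ suc b → coeff (Φ l) b ≢ + 0) →
         1 ≤ m → SquareFree m → ∀ {a} → deg (Φ m) ≡ suc a → coeff (Φ m) a ≢ + 0
  step m rec 1≤m sf {a} deg≡ with ℕ.m≤n⇒m<n∨m≡n 1≤m
  step m rec 1≤m sf {a} refl | inj₂ refl = λ ()
  ... | inj₁ 1<m with prime-factor 1<m
  ... | p@(suc q) , p-prime , divides l refl = λ coeff≡0 → rec l<m 1≤l sf-l (proj₂ deg-l) (begin
    coeff (Φ l) b                                     ≡⟨ ℤ.+-identityˡ _ ⟨
    + 0 ℤ.+ coeff (Φ l) b                             ≡⟨ cong (ℤ._+ coeff (Φ l) b) coeff≡0 ⟨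
    coeff (Φ (l * p)) a ℤ.+ coeff (Φ l) b             ≡⟨ ⊗-subleading (subst (Monic (Φ (l * p))) deg≡ (Φ-monic (l * p) 1≤m)) (subst (Monic (Φ l)) (proj₂ deg-l) (Φ-monic l 1≤l)) ⟨
    coeff (Φ (l * p) ⊗ Φ l) (suc (a + b))             ≡⟨ coeff-≡ (PrimeSubstitution.Φ-*-p-∤ p p-prime l 1≤l p∤l) (suc (a + b)) ⟩
    coeff (Φ l ∘X^ p) (suc (a + b))                   ≡⟨ cong (coeff (Φ l ∘X^ p)) index ⟩
    coeff (Φ l ∘X^ p) (b * p + q)                     ≡⟨ coeff-∘X^-≢0-mod p (Φ l) b q 0<q (ℕ.n<1+n q) ⟩
    + 0                                               ∎)
    where
    open ≡.≡-Reasoning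
    1≤l : 1 ≤ l
    1≤l = proj₁ (cofactor-bounds l p-prime 1≤m)
    l<m : l < l * p
    l<m = proj₂ (cofactor-bounds l p-prime 1≤m)
    0<q : 0 < q
    0<q = ℕ.≤-pred (prime≥2 p-prime)
    p∤l : ¬ p ∣ l
    p∤l p∣l = sf p p-prime (*-monoˡ-∣ p p∣l)
    sf-l : SquareFree l
    sf-l r r-prime r²∣l = sf r r-prime (∣-trans r²∣l (m∣m*n p))
    deg-l : ∃[ b ] deg (Φ l) ≡ suc b
    deg-l with deg (Φ l) | deg-Φ≥1 l 1≤l
    ... | suc b | _ = b , refl
    b : ℕ
    b = proj₁ deg-l
    index : suc (a + b) ≡ b * p + q
    index = begin
      suc a + b          ≡⟨ cong (_+ b) (trans (sym deg≡) (trans (deg-Φ-*-∤ p-prime 1≤l p∤l) (cong (_* q) (proj₂ deg-l)))) ⟩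
      suc b * q + b      ≡⟨ solve-∀-ℕ b q ⟩
      b * suc q + q      ∎
      where
      solve-∀-ℕ : ∀ b q → suc b * q + b ≡ b * suc q + q
      solve-∀-ℕ = ℕ.solve-∀

-- Cyclotomic polynomials with a gap in the upper half

UpperHalfGap : Poly → ℕ → Set
UpperHalfGap f a = ∀ j → a < 2 * j → j < a → coeff f j ≡ + 0

3-Smooth : ℕ → Set
3-Smooth m = ∀ r → Prime r → r ∣ m → r ≤ 3

Is2^i3^j : ℕ → Set
Is2^i3^j a = ∃[ i ] ∃[ j ] (1 ≤ i × a ≡ 2 ^ i * 3 ^ j)

squareFree? : ∀ m → 1 ≤ m → SquareFree m ⊎ ∃[ r ] Prime r × r * r ∣ m
squareFree? m 1≤m with ℕ.anyUpTo? (λ r → prime? r ×-dec r * r ∣? m) (suc m)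
... | yes (r , _ , r-prime , r²∣m) = inj₂ (r , r-prime , r²∣m)
... | no  ∄r                       = inj₁ λ r r-prime r²∣m → ∄r (r , s≤s (r≤m r-prime r²∣m) , r-prime , r²∣m)
  where
  r≤m : ∀ {r} → Prime r → r * r ∣ m → r ≤ m
  r≤m {r} r-prime r²∣m = ℕ.≤-trans (ℕ.m≤m*n r r {{prime⇒nonZero r-prime}}) (∣⇒≤ {{>-nonZero 1≤m}} r²∣m)

UpperHalfGap-∘X^ : ∀ p .{{_ : NonZero p}} {f b} → UpperHalfGap (f ∘X^ p) (b * p) → UpperHalfGap f b
UpperHalfGap-∘X^ p {f} {b} gap j b<2j j<b = trans (sym (coeff-∘X^-* p f j))
  (gap (j * p) (≡.subst (b * p <_) (ℕ.*-assoc 2 j p) (ℕ.*-monoˡ-< p b<2j)) (ℕ.*-monoˡ-< p j<b))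

Is1∨2^i3^j : ℕ → Set
Is1∨2^i3^j a = a ≡ 1 ⊎ Is2^i3^j a

shape-≤2 : ∀ {a} → 1 ≤ a → a ≤ 2 → Is1∨2^i3^j a
shape-≤2 {suc zero}          _ _             = inj₁ refl
shape-≤2 {suc (suc zero)}    _ _             = inj₂ (1 , 0 , s≤s z≤n , refl)
shape-≤2 {suc (suc (suc _))} _ (s≤s (s≤s ()))

shape-*-2 : ∀ {b} → Is1∨2^i3^j b → Is2^i3^j (b * 2)
shape-*-2 (inj₁ refl)                = 1 , 0 , s≤s z≤n , refl
shape-*-2 (inj₂ (i , j , 1≤i , refl)) = suc i , j , s≤s z≤n , lemma (2 ^ i) (3 ^ j)
  where
  lemma : ∀ x y → x * y * 2 ≡ 2 * x * y
  lemma = ℕ.solve-∀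

shape-*-3 : ∀ {b} → Is2^i3^j b → Is2^i3^j (b * 3)
shape-*-3 (i , j , 1≤i , refl) = i , suc j , 1≤i , lemma (2 ^ i) (3 ^ j)
  where
  lemma : ∀ x y → x * y * 3 ≡ x * (3 * y)
  lemma = ℕ.solve-∀

prime≤4⇒≤3 : ∀ {r} → Prime r → r ≤ 4 → r ≤ 3
prime≤4⇒≤3 r-prime r≤4 with ℕ.m≤n⇒m<n∨m≡n r≤4
... | inj₁ r<4 = ℕ.≤-pred r<4
... | inj₂ refl = contradiction r-prime (composite⇒¬prime composite[4])

-- The X^(a−1) coefficient is nonzero, so it lies outside the gap, forcing a ≤ 2; a prime factor ≥ 5
-- would force a ≥ 4.
squareFree-gap : ∀ {m} → 1 ≤ m → SquareFree m → UpperHalfGap (Φ m) (deg (Φ m)) → 3-Smooth m × Is1∨2^i3^j (deg (Φ m))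
squareFree-gap {m} 1≤m sf gap = smooth , shape-≤2 (deg-Φ≥1 m 1≤m) a≤2
  where
  a≤2 : deg (Φ m) ≤ 2
  a≤2 with deg (Φ m) in deg≡
  ... | zero                = z≤n
  ... | suc zero            = s≤s z≤n
  ... | suc (suc zero)      = s≤s (s≤s z≤n)
  ... | suc (suc (suc a))   = contradiction (gap (suc (suc a)) (lemma a) ℕ.≤-refl)
                                            (Φ-subleading≢0 m 1≤m sf deg≡)
    where
    lemma : ∀ a → 3 + a < 2 * (2 + a)
    lemma a = ≡.subst (4 + a ≤_) (sym (double a)) (ℕ.+-monoʳ-≤ 4 (ℕ.m≤m+n a a))
      where
      double : ∀ a → 2 * (2 + a) ≡ 4 + (a + a)
      double = ℕ.solve-∀
  smooth : 3-Smooth m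
  smooth r r-prime r∣m with 5 ℕ.≤? r
  ... | yes 5≤r = contradiction (ℕ.≤-trans (deg-Φ≥4 1≤m r-prime 5≤r r∣m) a≤2) λ { (s≤s (s≤s ())) }
  ... | no  r≱5 = prime≤4⇒≤3 r-prime (ℕ.≤-pred (ℕ.≰⇒> r≱5))

UpperHalfGap-cong : ∀ {f g a} → f ≈ g → UpperHalfGap f a → UpperHalfGap g a
UpperHalfGap-cong f≈g gap j a<2j j<a = trans (sym (coeff-≡ f≈g j)) (gap j a<2j j<a)

prime∣prime⇒≡ : ∀ {r p} → Prime r → Prime p → r ∣ p → r ≡ p
prime∣prime⇒≡ r-prime p-prime r∣p with prime⇒irreducible p-prime r∣p
... | inj₁ refl = contradiction r-prime ¬prime[1]
... | inj₂ r≡p  = r≡p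

3-Smooth-* : ∀ {l p} → 3-Smooth l → Prime p → p ≤ 3 → 3-Smooth (l * p)
3-Smooth-* {l} {p} smooth p-prime p≤3 r r-prime r∣lp with euclidsLemma l p r-prime r∣lp
... | inj₁ r∣l = smooth r r-prime r∣l
... | inj₂ r∣p = ≡.subst (_≤ 3) (sym (prime∣prime⇒≡ r-prime p-prime r∣p)) p≤3

shape-deg-* : ∀ {l p} → Prime p → 1 ≤ l → p ∣ l → p ≤ 3 → Is1∨2^i3^j (deg (Φ l)) → Is2^i3^j (deg (Φ l) * p)
shape-deg-* {l} {p} p-prime 1≤l p∣l p≤3 shape-l with ℕ.m≤n⇒m<n∨m≡n (prime≥2 p-prime)
... | inj₂ refl = shape-*-2 shape-l
... | inj₁ 3≤p with ℕ.≤-antisym p≤3 3≤p | shape-l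
...   | refl | inj₂ shape-l′ = shape-*-3 shape-l′
...   | refl | inj₁ deg≡1    = contradiction (deg-Φ≥2 l (∣⇒≤ {{>-nonZero 1≤l}} p∣l)) λ 2≤deg → ℕ.<-irrefl (sym deg≡1) 2≤deg

-- Φ_{lp} = Φ_l(X^p), so the gap descends to Φ_l, and deg Φ_{lp} = p·deg Φ_l.
square-factor-gap : ∀ {l p} → Prime p → 1 ≤ l → p ∣ l →
  (UpperHalfGap (Φ l) (deg (Φ l)) → 3-Smooth l × Is1∨2^i3^j (deg (Φ l))) →
  UpperHalfGap (Φ (l * p)) (deg (Φ (l * p))) → 3-Smooth (l * p) × Is1∨2^i3^j (deg (Φ (l * p)))
square-factor-gap {l} {p} p-prime 1≤l p∣l ih gap = 3-Smooth-* smooth-l p-prime p≤3 ,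
  inj₂ (≡.subst Is2^i3^j (sym deg≡) (shape-deg-* p-prime 1≤l p∣l p≤3 (proj₂ (ih gap-l))))
  where
  open PrimeSubstitution p p-prime
  deg≡ : deg (Φ (l * p)) ≡ deg (Φ l) * p
  deg≡ = deg-Φ-*-∣ p-prime 1≤l p∣l
  gap-l : UpperHalfGap (Φ l) (deg (Φ l))
  gap-l = UpperHalfGap-∘X^ p {Φ l} (UpperHalfGap-cong (Φ-*-p-∣ l 1≤l p∣l) (≡.subst (UpperHalfGap (Φ (l * p))) deg≡ gap))
  smooth-l : 3-Smooth l
  smooth-l = proj₁ (ih gap-l)
  p≤3 : p ≤ 3
  p≤3 = smooth-l p p-prime p∣l

square-divisor : ∀ {m} p → p * p ∣ m → ∃[ l ] m ≡ l * p × p ∣ l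
square-divisor p (divides k refl) = k * p , sym (ℕ.*-assoc k p p) , n∣m*n k

gap⇒shape : ∀ m → 1 ≤ m → UpperHalfGap (Φ m) (deg (Φ m)) → 3-Smooth m × Is1∨2^i3^j (deg (Φ m))
gap⇒shape = <-rec _ step
  where
  step : ∀ m → (∀ {l} → l < m → 1 ≤ l → UpperHalfGap (Φ l) (deg (Φ l)) → 3-Smooth l × Is1∨2^i3^j (deg (Φ l))) →
         1 ≤ m → UpperHalfGap (Φ m) (deg (Φ m)) → 3-Smooth m × Is1∨2^i3^j (deg (Φ m))
  step m rec 1≤m gap with squareFree? m 1≤m
  ... | inj₁ sf = squareFree-gap 1≤m sf gap
  ... | inj₂ (p , p-prime , p²∣m) with square-divisor p p²∣m
  ...   | l , refl , p∣l with cofactor-bounds l p-prime 1≤m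
  ...     | 1≤l , l<m = square-factor-gap p-prime 1≤l p∣l (rec l<m 1≤l) gap

-- The cyclotomic trinomials

trinomial : ℕ → Poly
trinomial k = X^ (2 * k) ⊝ X^ k ⊕ 1P

∘X^-trinomial : ∀ p .{{_ : NonZero p}} k → trinomial k ∘X^ p ≈ trinomial (k * p)
∘X^-trinomial p k = begin
  (X^ (2 * k) ⊝ X^ k ⊕ 1P) ∘X^ p
    ≈⟨ ≈-trans (∘X^-⊕ p (X^ (2 * k) ⊝ X^ k) 1P) (⊕-cong (∘X^-⊕ p (X^ (2 * k)) (negP (X^ k))) (≈-refl {1P ∘X^ p})) ⟩
  X^ (2 * k) ∘X^ p ⊕ negP (X^ k) ∘X^ p ⊕ 1P ∘X^ p
    ≈⟨ ⊕-cong (⊕-cong (≈-trans (∘X^-X^ p (2 * k)) (X^-cong (ℕ.*-assoc 2 k p))) (≈-trans (∘X^-negP p (X^ k)) (negP-cong (∘X^-X^ p k))))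
              (∘X^-X^ p 0) ⟩
  X^ (2 * (k * p)) ⊝ X^ (k * p) ⊕ 1P ∎
  where open ≈-Reasoning

coeff-trinomial : ∀ k j → coeff (trinomial k) j ≡ coeff (X^ (2 * k)) j ℤ.- coeff (X^ k) j ℤ.+ coeff 1P j
coeff-trinomial k j = trans (coeff-⊕ (X^ (2 * k) ⊝ X^ k) 1P j) (cong (ℤ._+ coeff 1P j) (coeff-⊝ (X^ (2 * k)) (X^ k) j))

coeff-trinomial-≢ : ∀ k {j} → j ≢ 2 * k → j ≢ k → j ≢ 0 → coeff (trinomial k) j ≡ + 0
coeff-trinomial-≢ k {j} j≢2k j≢k j≢0 =
  trans (coeff-trinomial k j) (cong₂ ℤ._+_ (cong₂ ℤ._-_ (coeff-X^-≢ (2 * k) j≢2k) (coeff-X^-≢ k j≢k)) (coeff-X^-≢ 0 j≢0))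

Monic-trinomial : ∀ k → 1 ≤ k → Monic (trinomial k) (2 * k)
Monic-trinomial k 1≤k = bounded , top
  where
  k<2k : k < 2 * k
  k<2k = ℕ.<-≤-trans (ℕ.m<m+n k 1≤k) (ℕ.≤-reflexive (cong (_+_ k) (sym (ℕ.+-identityʳ k))))
  bounded : trinomial k deg≤ 2 * k
  bounded j 2k<j = coeff-trinomial-≢ k (ℕ.>⇒≢ 2k<j) (ℕ.>⇒≢ (ℕ.<-trans k<2k 2k<j)) (ℕ.>⇒≢ (ℕ.≤-<-trans z≤n 2k<j))
  top : coeff (trinomial k) (2 * k) ≡ + 1
  top = trans (coeff-trinomial k (2 * k))
    (cong₂ ℤ._+_ (cong₂ ℤ._-_ (coeff-X^-≡ (2 * k)) (coeff-X^-≢ k (ℕ.>⇒≢ k<2k))) (coeff-X^-≢ 0 (ℕ.>⇒≢ (ℕ.≤-<-trans z≤n k<2k))))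

prime[3] : Prime 3
prime[3] = from-yes (prime? 3)

Φ-*-trinomial : ∀ {l k p} → Prime p → 1 ≤ l → p ∣ l → Φ l ≈ trinomial k → Φ (l * p) ≈ trinomial (k * p)
Φ-*-trinomial {l} {k} {p} p-prime 1≤l p∣l Φl≈ = begin
  Φ (l * p)            ≈⟨ Φ-*-p-∣ l 1≤l p∣l ⟩
  Φ l ∘X^ p            ≈⟨ ∘X^-cong p Φl≈ ⟩
  trinomial k ∘X^ p    ≈⟨ ∘X^-trinomial p k ⟩
  trinomial (k * p)    ∎
  where
  open ≈-Reasoning
  open PrimeSubstitution p p-prime

1≤2^i*3^j : ∀ i j → 1 ≤ 2 ^ i * 3 ^ j
1≤2^i*3^j i j = ℕ.*-mono-≤ (ℕ.m^n>0 2 i) (ℕ.m^n>0 3 j)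

Φ-2^i3^j : ∀ i j → Φ (2 ^ suc i * 3 ^ suc j) ≈ trinomial (2 ^ i * 3 ^ j)
Φ-2^i3^j zero    zero    = ≈-refl
Φ-2^i3^j zero    (suc j) = begin
  Φ (2 ^ 1 * 3 ^ suc (suc j))          ≡⟨ cong Φ (lemma₁ (3 ^ j)) ⟩
  Φ (2 ^ 1 * 3 ^ suc j * 3)            ≈⟨ Φ-*-trinomial {2 ^ 1 * 3 ^ suc j} {2 ^ 0 * 3 ^ j} prime[3] (1≤2^i*3^j 1 (suc j))
                                                        (divides (2 * 3 ^ j) (lemma₂ (3 ^ j))) (Φ-2^i3^j zero j) ⟩
  trinomial (2 ^ 0 * 3 ^ j * 3)        ≡⟨ cong trinomial (lemma₃ (3 ^ j)) ⟩
  trinomial (2 ^ 0 * 3 ^ suc j)        ∎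
  where
  open ≈-Reasoning
  lemma₁ : ∀ x → 2 * (3 * (3 * x)) ≡ 2 * (3 * x) * 3
  lemma₁ = ℕ.solve-∀
  lemma₂ : ∀ x → 2 * (3 * x) ≡ 2 * x * 3
  lemma₂ = ℕ.solve-∀
  lemma₃ : ∀ x → 1 * x * 3 ≡ 1 * (3 * x)
  lemma₃ = ℕ.solve-∀
Φ-2^i3^j (suc i) j       = begin
  Φ (2 ^ suc (suc i) * 3 ^ suc j)      ≡⟨ cong Φ (lemma₁ (2 ^ i) (3 ^ suc j)) ⟩
  Φ (2 ^ suc i * 3 ^ suc j * 2)        ≈⟨ Φ-*-trinomial {2 ^ suc i * 3 ^ suc j} {2 ^ i * 3 ^ j} prime[2] (1≤2^i*3^j (suc i) (suc j))
                                                        (divides (2 ^ i * 3 ^ suc j) (lemma₂ (2 ^ i) (3 ^ suc j))) (Φ-2^i3^j i j) ⟩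
  trinomial (2 ^ i * 3 ^ j * 2)        ≡⟨ cong trinomial (lemma₃ (2 ^ i) (3 ^ j)) ⟩
  trinomial (2 ^ suc i * 3 ^ j)        ∎
  where
  open ≈-Reasoning
  lemma₁ : ∀ x y → 2 * (2 * x) * y ≡ 2 * x * y * 2
  lemma₁ = ℕ.solve-∀
  lemma₂ : ∀ x y → 2 * x * y ≡ x * y * 2
  lemma₂ = ℕ.solve-∀
  lemma₃ : ∀ x y → x * y * 2 ≡ 2 * x * y
  lemma₃ = ℕ.solve-∀

HasClassForm-cong : ∀ {n p q} → p ≈ q → HasClassForm n p → HasClassForm n q
HasClassForm-cong {n} p≈q (deg≡n , top≡1 , gap) =
  trans (sym (deg-cong p≈q)) deg≡n , trans (sym (coeff-≡ p≈q n)) top≡1 ,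
  λ j n/2<j j<n → trans (sym (coeff-≡ p≈q j)) (gap j n/2<j j<n)

trinomial-classForm : ∀ k → 1 ≤ k → HasClassForm (2 * k) (trinomial k)
trinomial-classForm k 1≤k = Monic⇒deg≡ (Monic-trinomial k 1≤k) , Monic.leading (Monic-trinomial k 1≤k) , gap
  where
  gap : ∀ j → 2 * k / 2 < j → j < 2 * k → coeff (trinomial k) j ≡ + 0
  gap j 2k/2<j j<2k = coeff-trinomial-≢ k (ℕ.<⇒≢ j<2k) (ℕ.>⇒≢ k<j) (ℕ.>⇒≢ (ℕ.≤-<-trans z≤n k<j))
    where
    k<j : k < j
    k<j = ≡.subst (_< j) (trans (cong (_/ 2) (ℕ.*-comm 2 k)) (m*n/n≡m k 2)) 2k/2<j

2^i3^j⇒classForm : ∀ n → Is2^i3^j n → ∃[ m ] 1 ≤ m × HasClassForm n (Φ m)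
2^i3^j⇒classForm n (suc i , j , _ , n≡) = 2 ^ suc i * 3 ^ suc j , 1≤2^i*3^j (suc i) (suc j) ,
  ≡.subst (λ n → HasClassForm n (Φ (2 ^ suc i * 3 ^ suc j))) (sym (trans n≡ (ℕ.*-assoc 2 (2 ^ i) (3 ^ j))))
          (HasClassForm-cong (≈-sym (Φ-2^i3^j i j)) (trinomial-classForm (2 ^ i * 3 ^ j) (1≤2^i*3^j i j)))

classForm⇒2^i3^j : ∀ n → 2 ≤ n → ∃[ m ] 1 ≤ m × HasClassForm n (Φ m) → Is2^i3^j n
classForm⇒2^i3^j n 2≤n (m , 1≤m , deg≡n , _ , gap) =
  [ (λ deg≡1 → contradiction (trans (sym deg≡n) deg≡1) (ℕ.>⇒≢ 2≤n)) , subst Is2^i3^j deg≡n ]′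
    (proj₂ (gap⇒shape m 1≤m upper-gap))
  where
  upper-gap : UpperHalfGap (Φ m) (deg (Φ m))
  upper-gap j a<2j j<a = gap j (m<n*o⇒m/o<n (≡.subst (_< j * 2) deg≡n (≡.subst (deg (Φ m) <_) (ℕ.*-comm 2 j) a<2j)))
                             (≡.subst (j <_) deg≡n j<a)

proposition5 : (n : ℕ) → 2 ≤ n →
    (∃[ m ] (1 ≤ m × HasClassForm n (Φ m))) ⇔ (∃[ i ] ∃[ j ] (1 ≤ i × n ≡ 2 ^ i * 3 ^ j))
proposition5 n 2≤n = mk⇔ (classForm⇒2^i3^j n 2≤n) (2^i3^j⇒classForm n)
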